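{- Let $G$ be an $n$-vertex graph, let $R\subseteq V(G)$ and let $c:R\to\{1,\ldots,k\}$ be a (partial) colouring of its vertices. Let $t:\mathbb R_+\to\mathbb R_+$ be an increasing function such that every subgraph of $G$ with $x$ vertices has treewidth at most $t(x)$. Then there is a set $S\subseteq V(G)$ and a partition $A,B$ of $V(G)\setminus S$ such that $$|S|\le k+k\sum_{i=0}^{\lceil\log_{3/2}(n)\rceil}\left(t\left(\left(\tfrac23\right)^i n\right)+1\right),$$ there are no edges of $G$ between $A$ and $B$, and $\max\{|A\cap c^{ -1}(i)|,|B\cap c^{ -1}(i)|\}\le \frac{|c^{ -1}(i)|}{2}$ for each $i\in\{1,\ldots,k\}$.
   Formalization: The function t takes rational arguments and rational values, nonnegative and non-decreasing on nonnegative arguments, instead of mapping ℝ+ to ℝ+. -}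

module Defs where

open import Level using (0ℓ)
open import Data.Nat as ℕ using (ℕ; zero; suc; _^_)
open import Data.Nat.Properties using (m^n≢0)
open import Data.Integer using (+_)
open import Data.Fin using (Fin; _≟_)
open import Data.Fin.Subset using (Subset; _∈_; _∉_; _⊆_; ∣_∣)
open import Data.Maybe using (Maybe; just; nothing)
open import Data.Bool using (Bool; true; false)
open import Data.Vec using (tabulate)
open import Data.List using (List; []; _∷_)
open import Data.Product using (Σ; ∃; ∃-syntax; _×_; _,_)
open import Data.Sum using (_⊎_)
open import Data.Empty using (⊥)
open import Relation.Nullary using (¬_; does)
open import Relation.Binary.PropositionalEquality using (_≡_)
open import Data.Rational using (ℚ; _/_; _+_; _*_; 0ℚ; 1ℚ; _≤_)

record Graph (n : ℕ) : Set₁ where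
  field
    E     : Fin n → Fin n → Set
    sym   : ∀ {u v} → E u v → E v u
    irrefl : ∀ {u} → ¬ E u u
open Graph public

record Subgraph {n : ℕ} (G : Graph n) : Set₁ where
  field
    U      : Subset n
    F      : Fin n → Fin n → Set
    F-sym  : ∀ {u v} → F u v → F v u
    F⊆E    : ∀ {u v} → F u v → E G u v
    F-ends : ∀ {u v} → F u v → (u ∈ U) × (v ∈ U)
open Subgraph public

-- Trees, encoded as rooted trees on nodes Fin (suc m): node 0 is the root
-- and every other node j has a parent of strictly smaller index.

record Tree : Set where
  field
    m      : ℕ
    parent : (j : Fin m) → Fin (suc (Data.Fin.toℕ j))
open Tree public

open import Data.Fin using (toℕ; inject≤; fromℕ<)
Node : Tree → Set
Node T = Fin (suc (m T))

-- adjacency in the tree: j is the parent of j' or vice versa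
-- (node suc j has parent (parent T j) of index ≤ j)
parentOf : (T : Tree) → Fin (m T) → Node T
parentOf T j = fromℕ< {toℕ (parent T j)}
  (Data.Nat.Properties.≤-trans
     (Data.Fin.Properties.toℕ<n (parent T j))
     (Data.Nat.Properties.m≤n⇒m≤1+n (Data.Fin.Properties.toℕ<n j)))
  where import Data.Nat.Properties; import Data.Fin.Properties

TAdj : (T : Tree) → Node T → Node T → Set
TAdj T a b = (Σ (Fin (m T)) λ j → (a ≡ Data.Fin.suc j) × (b ≡ parentOf T j))
           ⊎ (Σ (Fin (m T)) λ j → (b ≡ Data.Fin.suc j) × (a ≡ parentOf T j))

data WalkIn (T : Tree) (P : Node T → Set) : Node T → Node T → Set where
  here : ∀ {a} → P a → WalkIn T P a a
  step : ∀ {a b c} → P a → TAdj T a b → WalkIn T P b c → WalkIn T P a c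

record TreeDecomposition {n : ℕ} {G : Graph n} (H : Subgraph G) : Set where
  field
    tree     : Tree
    bag      : Node tree → Subset n
    bag⊆U    : ∀ a → bag a ⊆ U H
    cover-v  : ∀ v → v ∈ U H → ∃[ a ] (v ∈ bag a)
    cover-e  : ∀ u v → F H u v → ∃[ a ] ((u ∈ bag a) × (v ∈ bag a))
    connected : ∀ v a b → v ∈ bag a → v ∈ bag b →
                WalkIn tree (λ c → v ∈ bag c) a b
open TreeDecomposition public

ℕtoℚ : ℕ → ℚ
ℕtoℚ x = (+ x) / 1

TreewidthAtMost : {n : ℕ} {G : Graph n} → Subgraph G → ℚ → Set
TreewidthAtMost H w =
  Σ (TreeDecomposition H) λ D → ∀ a → ℕtoℚ ∣ bag D a ∣ ≤ w + 1ℚ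

-- Colour classes of a partial colouring c : R → {1..k}, represented as
-- c : Fin n → Maybe (Fin k) (nothing = uncoloured, i.e. not in R).

colourClass : {n k : ℕ} → (Fin n → Maybe (Fin k)) → Fin k → Subset n
colourClass c i = tabulate λ v → f (c v)
  where
    f : Maybe _ → Bool
    f (just j) = does (j ≟ i)
    f nothing  = false

twoThirdsPow : ℕ → ℕ → ℚ
twoThirdsPow i n = (+ (2 ^ i ℕ.* n)) / (3 ^ i)
  where instance _ = m^n≢0 3 i

sumUpTo : ℕ → (ℕ → ℚ) → ℚ
sumUpTo zero    f = f 0
sumUpTo (suc L) f = sumUpTo L f + f (suc L)

-- Keep a labelling of the vertices as separator, side A, side B or member of a piece p, together
-- with shares x p ∈ [0,1] (the fraction of piece p counted on side A), such that no edge joins two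
-- different pieces or sides and every colour class is fractionally balanced; initially there is a
-- single piece of share ½. In round i every fractional piece is cut by the bag of a deepest node of
-- a tree decomposition whose subtree holds more than half of the piece: this costs at most
-- t((2/3)^i n) + 1 vertices and leaves parts of at most half the size. Then the shares are moved
-- inside the kernel of the k linear colour weights until at most k pieces are fractional, and the
-- pieces of share 1 or 0 join side A or B. After L rounds the at most k remaining pieces have at
-- most one vertex each and join the separator.

module Submission where

open import Defs hiding (sym)

module ℕtoℚ-Properties where
  open import Data.Nat as ℕ using (ℕ; suc; _^_; z≤n)
  import Data.Nat.Properties as ℕP
  open import Data.Integer as ℤ using (+_)
  import Data.Integer.Properties as ℤP
  open import Data.Rational
  import Data.Rational.Properties as ℚP
  import Data.Rational.Unnormalised as ℚᵘ
  import Data.Rational.Unnormalised.Properties as ℚᵘP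
  import Data.Nat.Coprimality as Coprimality
  open import Relation.Binary.PropositionalEquality

  mkℚ-ℕ : ℕ → ℚ
  mkℚ-ℕ m = mkℚ (+ m) 0 (Coprimality.sym (Coprimality.1-coprimeTo m))

  ℕtoℚ≡mkℚ : ∀ m → ℕtoℚ m ≡ mkℚ-ℕ m
  ℕtoℚ≡mkℚ m = ℚP.↥p/↧p≡p (mkℚ-ℕ m)

  ℕtoℚ-+ : ∀ a b → ℕtoℚ (a ℕ.+ b) ≡ ℕtoℚ a + ℕtoℚ b
  ℕtoℚ-+ a b rewrite ℕtoℚ≡mkℚ (a ℕ.+ b) | ℕtoℚ≡mkℚ a | ℕtoℚ≡mkℚ b =
    ℚP.toℚᵘ-injective (ℚᵘP.≃-trans (ℚᵘ.*≡* eq) (ℚᵘP.≃-sym (ℚP.toℚᵘ-homo-+ (mkℚ-ℕ a) (mkℚ-ℕ b))))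
    where
    eq : + (a ℕ.+ b) ℤ.* + 1 ≡ (+ a ℤ.* + 1 ℤ.+ + b ℤ.* + 1) ℤ.* + 1
    eq rewrite ℤP.*-identityʳ (+ a) | ℤP.*-identityʳ (+ b) | ℤP.*-identityʳ (+ a ℤ.+ + b) = refl

  ℕtoℚ-* : ∀ a b → ℕtoℚ (a ℕ.* b) ≡ ℕtoℚ a * ℕtoℚ b
  ℕtoℚ-* a b rewrite ℕtoℚ≡mkℚ (a ℕ.* b) | ℕtoℚ≡mkℚ a | ℕtoℚ≡mkℚ b =
    ℚP.toℚᵘ-injective (ℚᵘP.≃-trans (ℚᵘ.*≡* (cong (ℤ._* + 1) (ℤP.pos-* a b))) (ℚᵘP.≃-sym (ℚP.toℚᵘ-homo-* (mkℚ-ℕ a) (mkℚ-ℕ b))))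

  ℕtoℚ-mono-≤ : ∀ {a b} → a ℕ.≤ b → ℕtoℚ a ≤ ℕtoℚ b
  ℕtoℚ-mono-≤ {a} {b} a≤b rewrite ℕtoℚ≡mkℚ a | ℕtoℚ≡mkℚ b = *≤* (ℤP.*-monoʳ-≤-nonNeg (+ 1) (ℤ.+≤+ a≤b))

  ℕtoℚ-cancel-≤ : ∀ {a b} → ℕtoℚ a ≤ ℕtoℚ b → a ℕ.≤ b
  ℕtoℚ-cancel-≤ {a} {b} le rewrite ℕtoℚ≡mkℚ a | ℕtoℚ≡mkℚ b with le
  ... | *≤* p = ℤ.drop‿+≤+ (subst₂ ℤ._≤_ (ℤP.*-identityʳ (+ a)) (ℤP.*-identityʳ (+ b)) p)

  ℕtoℚ-nonNeg : ∀ m → 0ℚ ≤ ℕtoℚ m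
  ℕtoℚ-nonNeg m = ℕtoℚ-mono-≤ {0} {m} z≤n

  ℕtoℚ≤/ : ∀ r m d → r ℕ.* suc d ℕ.≤ m → ℕtoℚ r ≤ + m / suc d
  ℕtoℚ≤/ r m d le rewrite ℕtoℚ≡mkℚ r =
    ℚP.toℚᵘ-cancel-≤ (ℚᵘP.≤-respʳ-≃ (ℚᵘP.≃-sym (ℚP.toℚᵘ-fromℚᵘ (ℚᵘ.mkℚᵘ (+ m) d))) (ℚᵘ.*≤* le′))
    where
    le′ : + r ℤ.* + suc d ℤ.≤ + m ℤ.* + 1
    le′ rewrite ℤP.*-identityʳ (+ m) | sym (ℤP.pos-* r (suc d)) = ℤ.+≤+ le

  ℕtoℚ≤twoThirdsPow : ∀ i n r → 3 ^ i ℕ.* r ℕ.≤ 2 ^ i ℕ.* n → ℕtoℚ r ≤ twoThirdsPow i n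
  ℕtoℚ≤twoThirdsPow i n r le with 3 ^ i | ℕP.m^n≢0 3 i
  ... | suc d | _ = ℕtoℚ≤/ r (2 ^ i ℕ.* n) d (subst (ℕ._≤ 2 ^ i ℕ.* n) (ℕP.*-comm (suc d) r) le)

open ℕtoℚ-Properties

module Counting where
  open import Data.Nat as ℕ using (ℕ; zero; suc; _+_; _≤_; _<_; z≤n; s≤s)
  import Data.Nat.Properties as ℕP
  open import Data.Bool using (Bool; true; false; T; if_then_else_; _∧_; _∨_; not)
  open import Data.Bool.Properties using (T-∧; T-∨; T-≡)
  import Data.Bool.Properties
  open import Data.Fin as Fin using (Fin; zero; suc; toℕ)
  open import Data.Fin.Properties using (any?)
  open import Data.Fin.Subset using (Subset; _∈_; ∣_∣)
  open import Data.Vec using ([]; _∷_; lookup; tabulate)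
  open import Data.Vec.Properties using (lookup∘tabulate; []=⇒lookup; lookup⇒[]=)
  open import Data.Unit using (tt)
  open import Data.Empty using (⊥-elim)
  open import Data.Product using (∃; _×_; _,_; proj₁; proj₂)
  open import Data.Sum using (_⊎_; inj₁; inj₂)
  open import Function using (_∘_; Equivalence)
  open import Relation.Nullary using (¬_; yes; no)
  open import Relation.Nullary.Decidable using (isYes; T?)
  open import Relation.Binary.PropositionalEquality

  private variable n : ℕ

  ∧-intro : ∀ {a b} → T a → T b → T (a ∧ b)
  ∧-intro p q = Equivalence.from T-∧ (p , q)

  ∧-elimˡ : ∀ {a b} → T (a ∧ b) → T a
  ∧-elimˡ = proj₁ ∘ Equivalence.to T-∧

  ∧-elimʳ : ∀ {a b} → T (a ∧ b) → T b
  ∧-elimʳ = proj₂ ∘ Equivalence.to T-∧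

  ∨-introˡ : ∀ {a} b → T a → T (a ∨ b)
  ∨-introˡ b Ta = Equivalence.from T-∨ (inj₁ Ta)

  ∨-introʳ : ∀ a {b} → T b → T (a ∨ b)
  ∨-introʳ a Tb = Equivalence.from T-∨ (inj₂ Tb)

  not-intro : ∀ {a} → ¬ T a → T (not a)
  not-intro {false} _ = tt
  not-intro {true} ¬a = ¬a tt

  not-elim : ∀ {a} → T (not a) → ¬ T a
  not-elim {false} _ ()

  T-lookup⇒∈ : ∀ (s : Subset n) {v} → T (lookup s v) → v ∈ s
  T-lookup⇒∈ s {v} sv = lookup⇒[]= v s (Equivalence.to T-≡ sv)

  ∈⇒T-lookup : ∀ {s : Subset n} {v} → v ∈ s → T (lookup s v)
  ∈⇒T-lookup v∈s = Equivalence.from T-≡ ([]=⇒lookup v∈s)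

  ∈-tabulate⁺ : ∀ (f : Fin n → Bool) {v} → T (f v) → v ∈ tabulate f
  ∈-tabulate⁺ f {v} fv = T-lookup⇒∈ (tabulate f) (subst T (sym (lookup∘tabulate f v)) fv)

  ∈-tabulate⁻ : ∀ (f : Fin n → Bool) {v} → v ∈ tabulate f → T (f v)
  ∈-tabulate⁻ f {v} v∈ = subst T (lookup∘tabulate f v) (∈⇒T-lookup v∈)

  infixl 6 _∖_

  _∖_ : (f g : Fin n → Bool) → Fin n → Bool
  (f ∖ g) v = f v ∧ not (g v)

  count : (Fin n → Bool) → ℕ
  count {zero} f = 0
  count {suc n} f = (if f zero then 1 else 0) + count (f ∘ suc)

  ∣∣≡count : (s : Subset n) → ∣ s ∣ ≡ count (lookup s)
  ∣∣≡count [] = refl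
  ∣∣≡count (true ∷ s) = cong suc (∣∣≡count s)
  ∣∣≡count (false ∷ s) = ∣∣≡count s

  ∣tabulate∣≡count : (f : Fin n → Bool) → ∣ tabulate f ∣ ≡ count f
  ∣tabulate∣≡count {zero} f = refl
  ∣tabulate∣≡count {suc n} f with f zero
  ... | true = cong suc (∣tabulate∣≡count (f ∘ suc))
  ... | false = ∣tabulate∣≡count (f ∘ suc)

  count-mono : (f g : Fin n → Bool) → (∀ v → T (f v) → T (g v)) → count f ≤ count g
  count-mono {zero} f g f⊆g = z≤n
  count-mono {suc n} f g f⊆g with f zero in f0 | g zero in g0
  ... | false | false = count-mono _ _ (f⊆g ∘ suc)
  ... | false | true = ℕP.m≤n⇒m≤1+n (count-mono _ _ (f⊆g ∘ suc))
  ... | true | true = s≤s (count-mono _ _ (f⊆g ∘ suc))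
  ... | true | false = ⊥-elim (subst T g0 (f⊆g zero (subst T (sym f0) tt)))

  count-cong : (f g : Fin n → Bool) → (∀ v → f v ≡ g v) → count f ≡ count g
  count-cong {zero} f g f≗g = refl
  count-cong {suc n} f g f≗g = cong₂ _+_ (cong (λ b → if b then 1 else 0) (f≗g zero)) (count-cong _ _ (f≗g ∘ suc))

  count-none : (f : Fin n → Bool) → (∀ v → ¬ T (f v)) → count f ≡ 0
  count-none {zero} f none = refl
  count-none {suc n} f none with f zero in f0
  ... | false = count-none (f ∘ suc) (none ∘ suc)
  ... | true = ⊥-elim (none zero (subst T (sym f0) tt))

  count≤n : (f : Fin n → Bool) → count f ≤ n
  count≤n {zero} f = z≤n
  count≤n {suc n} f with f zero
  ... | false = ℕP.m≤n⇒m≤1+n (count≤n (f ∘ suc))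
  ... | true = s≤s (count≤n (f ∘ suc))

  count-∨ : (f g : Fin n → Bool) → count (λ v → f v ∨ g v) ≤ count f + count g
  count-∨ {zero} f g = z≤n
  count-∨ {suc n} f g with f zero | g zero | count-∨ (f ∘ suc) (g ∘ suc)
  ... | false | false | ih = ih
  ... | false | true | ih = ℕP.≤-trans (s≤s ih) (ℕP.≤-reflexive (sym (ℕP.+-suc _ _)))
  ... | true | false | ih = s≤s ih
  ... | true | true | ih = s≤s (ℕP.≤-trans ih (ℕP.≤-trans (ℕP.n≤1+n _) (ℕP.≤-reflexive (sym (ℕP.+-suc _ _)))))

  count-split : (f g : Fin n → Bool) → count f ≡ count (λ v → f v ∧ g v) + count (f ∖ g)
  count-split {zero} f g = refl
  count-split {suc n} f g with f zero | g zero | count-split (f ∘ suc) (g ∘ suc)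
  ... | false | _ | ih = ih
  ... | true | true | ih = cong suc ih
  ... | true | false | ih = trans (cong suc ih) (sym (ℕP.+-suc _ _))

  _without_ : (Fin n → Bool) → Fin n → Fin n → Bool
  f without j = f ∖ λ v → isYes (v Fin.≟ j)

  count-without : (f : Fin n → Bool) (j : Fin n) → T (f j) → suc (count (f without j)) ≡ count f
  count-without f zero fj with f zero
  ... | true = cong suc (count-cong _ _ λ v → Data.Bool.Properties.∧-identityʳ (f (suc v)))
  count-without {suc n} f (suc j) fj =
    trans (cong suc (count-cong _ g pointwise))
          (trans (sym (ℕP.+-suc _ _)) (cong ((if f zero then 1 else 0) +_) (count-without (f ∘ suc) j fj)))
    where
    g : Fin (suc n) → Bool
    g zero = f zero
    g (suc v) = ((f ∘ suc) without j) v
    pointwise : ∀ v → (f without suc j) v ≡ g v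
    pointwise zero with zero Fin.≟ suc j
    ... | no _ = Data.Bool.Properties.∧-identityʳ (f zero)
    pointwise (suc v) with suc v Fin.≟ suc j | v Fin.≟ j
    ... | yes _ | yes _ = refl
    ... | no _ | no _ = refl
    ... | yes refl | no v≢j = ⊥-elim (v≢j refl)
    ... | no sv≢sj | yes refl = ⊥-elim (sv≢sj refl)

  count>0⇒∃ : (f : Fin n → Bool) → 0 < count f → ∃ λ j → T (f j)
  count>0⇒∃ {suc n} f pos with f zero in f0
  ... | true = zero , subst T (sym f0) tt
  ... | false with count>0⇒∃ (f ∘ suc) pos
  ... | j , fj = suc j , fj

  ∃⇒count>0 : (f : Fin n → Bool) {j : Fin n} → T (f j) → 0 < count f
  ∃⇒count>0 f {j} fj = subst (0 <_) (count-without f j fj) (s≤s z≤n)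

  canonical : (Fin n → Bool) → Fin n → Fin n
  canonical f v with any? (T? ∘ f)
  ... | yes (q , _) = q
  ... | no _ = v

  canonical∈ : ∀ (f : Fin n → Bool) {v} → T (f v) → T (f (canonical f v))
  canonical∈ f {v} fv with any? (T? ∘ f)
  ... | yes (_ , fq) = fq
  ... | no none = ⊥-elim (none (v , fv))

  canonical-unique : ∀ (f : Fin n → Bool) {v w} → T (f v) → T (f w) → canonical f v ≡ canonical f w
  canonical-unique f {v} fv fw with any? (T? ∘ f)
  ... | yes _ = refl
  ... | no none = ⊥-elim (none (v , fv))

  greatest : (Q : Fin n → Bool) →
    (∀ b → ¬ T (Q b)) ⊎ ∃ λ a → T (Q a) × (∀ b → toℕ a < toℕ b → ¬ T (Q b))
  greatest {zero} Q = inj₁ λ ()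
  greatest {suc n} Q with greatest (Q ∘ suc)
  ... | inj₂ (a , Qa , max) = inj₂ (suc a , Qa , λ { zero () ; (suc b) (s≤s a<b) → max b a<b })
  ... | inj₁ none with Q zero in Q0
  ... | true = inj₂ (zero , subst T (sym Q0) tt , λ { zero () ; (suc b) _ → none b })
  ... | false = inj₁ λ { zero Qb → subst T Q0 Qb ; (suc b) → none b }

  ⋃ : ∀ {m n} → (Fin m → Bool) → (Fin m → Fin n → Bool) → Fin n → Bool
  ⋃ {zero} I X v = false
  ⋃ {suc m} I X v = (I zero ∧ X zero v) ∨ ⋃ (I ∘ suc) (X ∘ suc) v

  ∈⋃ : ∀ {m n} (I : Fin m → Bool) (X : Fin m → Fin n → Bool) {p v} → T (I p) → T (X p v) → T (⋃ I X v)
  ∈⋃ {suc m} I X {zero} Ip Xpv = ∨-introˡ _ (∧-intro Ip Xpv)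
  ∈⋃ {suc m} I X {suc p} {v} Ip Xpv = ∨-introʳ (I zero ∧ X zero v) (∈⋃ (I ∘ suc) (X ∘ suc) Ip Xpv)

open Counting

module Subtrees (T : Tree) where

  open import Data.Nat using (suc; _≤_; _<_; s≤s)
  import Data.Nat.Properties as ℕP
  open import Data.Fin as Fin using (Fin; zero; suc; toℕ)
  import Data.Fin.Properties as FinP
  open import Data.Empty using (⊥-elim)
  open import Data.Product using (Σ; ∃; _×_; _,_)
  open import Data.Sum using (_⊎_; inj₁; inj₂)
  open import Relation.Nullary using (¬_; Dec; yes; no)
  open import Relation.Binary.PropositionalEquality

  infix 4 _⊑_

  data _⊑_ (a : Node T) : Node T → Set where
    ⊑-refl : a ⊑ a
    ⊑-child : ∀ j → a ⊑ parentOf T j → a ⊑ suc j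

  toℕ-parentOf≤ : ∀ j → toℕ (parentOf T j) ≤ toℕ j
  toℕ-parentOf≤ j = ℕP.≤-trans (ℕP.≤-reflexive (FinP.toℕ-fromℕ< _)) (ℕP.≤-pred (FinP.toℕ<n (parent T j)))

  ⊑⇒toℕ≤ : ∀ {a b} → a ⊑ b → toℕ a ≤ toℕ b
  ⊑⇒toℕ≤ ⊑-refl = ℕP.≤-refl
  ⊑⇒toℕ≤ (⊑-child j a⊑p) = ℕP.≤-trans (⊑⇒toℕ≤ a⊑p) (ℕP.m≤n⇒m≤1+n (toℕ-parentOf≤ j))

  ⊑-trans : ∀ {a b c} → a ⊑ b → b ⊑ c → a ⊑ c
  ⊑-trans a⊑b ⊑-refl = a⊑b
  ⊑-trans a⊑b (⊑-child j b⊑p) = ⊑-child j (⊑-trans a⊑b b⊑p)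

  private
    ⊑?-bounded : ∀ bound a b → toℕ b ≤ bound → Dec (a ⊑ b)
    ⊑?-bounded bound a b b≤ with a Fin.≟ b
    ... | yes refl = yes ⊑-refl
    ⊑?-bounded bound a zero b≤ | no a≢b = no λ { ⊑-refl → a≢b refl }
    ⊑?-bounded (suc bound) a (suc j) (s≤s b≤) | no a≢b
      with ⊑?-bounded bound a (parentOf T j) (ℕP.≤-trans (toℕ-parentOf≤ j) b≤)
    ... | yes a⊑p = yes (⊑-child j a⊑p)
    ... | no a⋢p = no λ { ⊑-refl → a≢b refl ; (⊑-child .j a⊑p) → a⋢p a⊑p }

    root⊑-bounded : ∀ bound b → toℕ b ≤ bound → zero ⊑ b
    root⊑-bounded bound zero _ = ⊑-refl
    root⊑-bounded (suc bound) (suc j) (s≤s b≤) =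
      ⊑-child j (root⊑-bounded bound (parentOf T j) (ℕP.≤-trans (toℕ-parentOf≤ j) b≤))

  _⊑?_ : ∀ a b → Dec (a ⊑ b)
  a ⊑? b = ⊑?-bounded (toℕ b) a b ℕP.≤-refl

  root⊑ : ∀ b → zero ⊑ b
  root⊑ b = root⊑-bounded (toℕ b) b ℕP.≤-refl

  ⊑-comparable : ∀ {a b c} → a ⊑ c → b ⊑ c → a ⊑ b ⊎ b ⊑ a
  ⊑-comparable ⊑-refl b⊑c = inj₂ b⊑c
  ⊑-comparable (⊑-child j a⊑p) ⊑-refl = inj₁ (⊑-child j a⊑p)
  ⊑-comparable (⊑-child j a⊑p) (⊑-child .j b⊑p) = ⊑-comparable a⊑p b⊑p

  ChildOf : Node T → Node T → Set
  ChildOf a c = Σ (Fin (m T)) λ j → (c ≡ suc j) × (parentOf T j ≡ a)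

  childOf? : ∀ a c → Dec (ChildOf a c)
  childOf? a zero = no λ { (_ , () , _) }
  childOf? a (suc j) with parentOf T j Fin.≟ a
  ... | yes p≡a = yes (j , refl , p≡a)
  ... | no p≢a = no λ { (.j , refl , p≡a) → p≢a p≡a }

  ChildOf⇒toℕ< : ∀ {a c} → ChildOf a c → toℕ a < toℕ c
  ChildOf⇒toℕ< (j , refl , refl) = s≤s (toℕ-parentOf≤ j)

  ChildOf⇒⊑ : ∀ {a c} → ChildOf a c → a ⊑ c
  ChildOf⇒⊑ (j , refl , refl) = ⊑-child j ⊑-refl

  child-above : ∀ {a d} → a ⊑ d → d ≢ a → ∃ λ c → ChildOf a c × c ⊑ d
  child-above ⊑-refl d≢a = ⊥-elim (d≢a refl)
  child-above {a} (⊑-child j a⊑p) _ with parentOf T j Fin.≟ a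
  ... | yes p≡a = suc j , (j , refl , p≡a) , ⊑-refl
  ... | no p≢a with child-above a⊑p p≢a
  ... | c , c-child , c⊑p = c , c-child , ⊑-child j c⊑p

  sibling-⊑ : ∀ {a c c′} → ChildOf a c → ChildOf a c′ → c ⊑ c′ → c ≡ c′
  sibling-⊑ _ _ ⊑-refl = refl
  sibling-⊑ ch (j , refl , p≡a) (⊑-child .j c⊑p) =
    ⊥-elim (ℕP.<⇒≱ (ChildOf⇒toℕ< ch) (⊑⇒toℕ≤ (subst (_ ⊑_) p≡a c⊑p)))

  children-disjoint : ∀ {a c₁ c₂ d} → ChildOf a c₁ → ChildOf a c₂ → c₁ ⊑ d → c₂ ⊑ d → c₁ ≡ c₂
  children-disjoint ch₁ ch₂ c₁⊑d c₂⊑d with ⊑-comparable c₁⊑d c₂⊑d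
  ... | inj₁ c₁⊑c₂ = sibling-⊑ ch₁ ch₂ c₁⊑c₂
  ... | inj₂ c₂⊑c₁ = sym (sibling-⊑ ch₂ ch₁ c₂⊑c₁)

  parent-unique : ∀ {a a′ c} → ChildOf a c → ChildOf a′ c → a ≡ a′
  parent-unique (j , refl , refl) (.j , refl , p≡a′) = p≡a′

  exit-subtree : ∀ {a p q} → TAdj T p q → a ⊑ p → ¬ a ⊑ q → p ≡ a × ChildOf q a
  exit-subtree (inj₁ (j , refl , refl)) ⊑-refl _ = refl , (j , refl , refl)
  exit-subtree (inj₁ (j , refl , refl)) (⊑-child .j a⊑q) a⋢q = ⊥-elim (a⋢q a⊑q)
  exit-subtree (inj₂ (j , refl , refl)) a⊑p a⋢q = ⊥-elim (a⋢q (⊑-child j a⊑p))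

  walk-start : ∀ {P a b} → WalkIn T P a b → P a
  walk-start (here Pa) = Pa
  walk-start (step Pa _ _) = Pa

  walk-exit : ∀ {P} a {x y} → WalkIn T P x y → a ⊑ x → ¬ a ⊑ y → P a × ∃ λ q → ChildOf q a × P q
  walk-exit a (here _) a⊑x a⋢y = ⊥-elim (a⋢y a⊑x)
  walk-exit a (step {b = b} Px x~b w) a⊑x a⋢y with a ⊑? b
  ... | yes a⊑b = walk-exit a w a⊑b a⋢y
  ... | no a⋢b with exit-subtree x~b a⊑x a⋢b
  ... | refl , ch = Px , b , ch , walk-start w

module Separators where
  open import Data.Nat as ℕ using (ℕ; _≤_; _<_; z≤n)
  import Data.Nat.Properties as ℕP
  open import Data.Bool using (Bool; false; T; _∧_; not)
  open import Data.Fin as Fin using (Fin; zero; toℕ)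
  open import Data.Fin.Properties using (any?)
  open import Data.Fin.Subset using (_∈_; _∉_; ∣_∣)
  open import Data.Fin.Subset.Properties using (_∈?_)
  open import Data.Maybe using (Maybe; just; nothing)
  import Data.Maybe.Properties as MaybeP
  open import Data.Vec using (tabulate; lookup)
  open import Data.Rational using (ℚ; 0ℚ; 1ℚ) renaming (_≤_ to _≤ℚ_; _+_ to _+ℚ_)
  import Data.Rational.Properties as ℚP
  open import Data.Empty using (⊥-elim)
  open import Data.Product using (∃; _×_; _,_; proj₁; proj₂)
  open import Data.Sum using (inj₁; inj₂)
  open import Function using (_∘_)
  open import Relation.Nullary using (¬_; Dec; yes; no)
  open import Relation.Nullary.Decidable using (isYes; T?; _×-dec_; toWitness; fromWitness)
  open import Relation.Binary.PropositionalEquality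

  half-of-sum : ∀ a b → a ℕ.+ b < 2 ℕ.* a → 2 ℕ.* b ≤ a ℕ.+ b
  half-of-sum a b a+b<2a = subst (_≤ a ℕ.+ b) (cong (b ℕ.+_) (sym (ℕP.+-identityʳ b))) (ℕP.+-monoˡ-≤ b (ℕP.<⇒≤ b<a))
    where
    b<a : b < a
    b<a = ℕP.+-cancelˡ-< a b a (subst (a ℕ.+ b <_) (cong (a ℕ.+_) (ℕP.+-identityʳ a)) a+b<2a)

  module BalancedSeparators {n : ℕ} (G : Graph n) (t : ℚ → ℚ)
    (t-nonNeg : ∀ x → 0ℚ ≤ℚ x → 0ℚ ≤ℚ t x)
    (tw : ∀ (H : Subgraph G) → TreewidthAtMost H (t (ℕtoℚ ∣ U H ∣))) where

    fibre : (Fin n → Fin n) → Fin n → Fin n → Bool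
    fibre r q w = isYes (r w Fin.≟ q)

    -- The fibres of rep partition P ∖ X into parts that no edge joins.
    record BalancedSeparator (P : Fin n → Bool) : Set where
      field
        X : Fin n → Bool
        X-size : ℕtoℚ (count X) ≤ℚ t (ℕtoℚ (count P)) +ℚ 1ℚ
        rep : Fin n → Fin n
        rep∈ : ∀ v → T ((P ∖ X) v) → T ((P ∖ X) (rep v))
        rep-edge : ∀ u w → T ((P ∖ X) u) → T ((P ∖ X) w) → E G u w → rep u ≡ rep w
        rep-fibre-small : ∀ q → 2 ℕ.* count (λ w → (P ∖ X) w ∧ fibre rep q w) ≤ count P

    induced : (Fin n → Bool) → Subgraph G
    induced P = record
      { U = tabulate P
      ; F = λ u v → E G u v × T (P u) × T (P v)
      ; F-sym = λ (e , Pu , Pv) → Graph.sym G e , Pv , Pu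
      ; F⊆E = proj₁
      ; F-ends = λ (_ , Pu , Pv) → ∈-tabulate⁺ P Pu , ∈-tabulate⁺ P Pv
      }

    module Decomposition (P : Fin n → Bool) where

      D : TreeDecomposition (induced P)
      D = proj₁ (tw (induced P))

      open Subtrees (tree D)

      B⊆P : ∀ {d v} → v ∈ bag D d → T (P v)
      B⊆P v∈d = ∈-tabulate⁻ P (bag⊆U D _ v∈d)

      InSubtree : Node (tree D) → Fin n → Set
      InSubtree a v = ∃ λ d → a ⊑ d × v ∈ bag D d

      opaque
        inSubtree? : ∀ a v → Dec (InSubtree a v)
        inSubtree? a v = any? λ d → (a ⊑? d) ×-dec (v ∈? bag D d)

      inSubtree : Node (tree D) → Fin n → Bool
      inSubtree a v = isYes (inSubtree? a v)

      leave-subtree : ∀ {a u e} → InSubtree a u → u ∈ bag D e → ¬ a ⊑ e →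
                      u ∈ bag D a × ∃ λ q → ChildOf q a × u ∈ bag D q
      leave-subtree {a} {u} {e} (d , a⊑d , u∈d) u∈e a⋢e = walk-exit a (connected D u d e u∈d u∈e) a⊑d a⋢e

      edge-leaves-subtree : ∀ {a u w} → InSubtree a u → T (P w) → ¬ InSubtree a w → E G u w →
                            u ∈ bag D a × ∃ λ q → ChildOf q a × u ∈ bag D q
      edge-leaves-subtree {a} {u} {w} u-in@(_ , _ , u∈d) Pw w-out uw
        with cover-e D u w (uw , B⊆P u∈d , Pw)
      ... | e , u∈e , w∈e = leave-subtree u-in u∈e (λ a⊑e → w-out (e , a⊑e , w∈e))

      heavy : Node (tree D) → Bool
      heavy a = isYes (count P ℕ.<? 2 ℕ.* count (inSubtree a))

      root-heavy : ∀ {v} → T (P v) → T (heavy zero)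
      root-heavy {v} Pv = fromWitness (ℕP.<-≤-trans P<2P (ℕP.*-monoʳ-≤ 2 P≤root))
        where
        P≤root : count P ≤ count (inSubtree zero)
        P≤root = count-mono P (inSubtree zero) λ w Pw →
          let (d , w∈d) = cover-v D w (∈-tabulate⁺ P Pw) in fromWitness (d , root⊑ d , w∈d)
        P<2P : count P < 2 ℕ.* count P
        P<2P = subst (count P <_) (cong (count P ℕ.+_) (sym (ℕP.+-identityʳ (count P))))
                     (ℕP.m<m+n (count P) (∃⇒count>0 P Pv))

      -- Removing the bag of a splits P into the subtrees of the children of a and the rest of P;
      -- since a is a deepest heavy node, each of these holds at most half of P.
      module DeepestHeavy (a : Node (tree D)) (a-heavy : T (heavy a))
                          (deeper-light : ∀ b → toℕ a < toℕ b → ¬ T (heavy b)) where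

        X : Fin n → Bool
        X = lookup (bag D a)

        ∈P : ∀ {v} → T ((P ∖ X) v) → T (P v)
        ∈P {v} = ∧-elimˡ {P v}

        ∉X : ∀ {v} → T ((P ∖ X) v) → ¬ T (X v)
        ∉X {v} = not-elim ∘ ∧-elimʳ {P v}

        child-light : ∀ {c} → ChildOf a c → 2 ℕ.* count (inSubtree c) ≤ count P
        child-light ch = ℕP.≮⇒≥ λ heavy-c → deeper-light _ (ChildOf⇒toℕ< ch) (fromWitness heavy-c)

        outside-light : 2 ℕ.* count (P ∖ inSubtree a) ≤ count P
        outside-light = subst (2 ℕ.* count (P ∖ inSubtree a) ≤_) (sym split)
          (half-of-sum inside (count (P ∖ inSubtree a)) (subst (_< 2 ℕ.* inside) split
            (ℕP.<-≤-trans (toWitness a-heavy) (ℕP.*-monoʳ-≤ 2 sub≤inside))))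
          where
          inside : ℕ
          inside = count (λ v → P v ∧ inSubtree a v)
          split : count P ≡ inside ℕ.+ count (P ∖ inSubtree a)
          split = count-split P (inSubtree a)
          sub≤inside : count (inSubtree a) ≤ inside
          sub≤inside = count-mono _ _ λ v sub → ∧-intro (B⊆P (proj₂ (proj₂ (toWitness {a? = inSubtree? a v} sub)))) sub

        child-unique : ∀ {c₁ c₂ v} → ChildOf a c₁ → ChildOf a c₂ → InSubtree c₁ v → InSubtree c₂ v →
                       ¬ T (X v) → c₁ ≡ c₂
        child-unique {c₁} ch₁ ch₂ v-in₁ (d₂ , c₂⊑d₂ , v∈d₂) v∉X with c₁ ⊑? d₂
        ... | yes c₁⊑d₂ = children-disjoint ch₁ ch₂ c₁⊑d₂ c₂⊑d₂
        ... | no c₁⋢d₂ with leave-subtree v-in₁ v∈d₂ c₁⋢d₂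
        ... | _ , q , q-parent , v∈q with parent-unique q-parent ch₁
        ... | refl = ⊥-elim (v∉X (∈⇒T-lookup v∈q))

        InSubtree-child : ∀ {c v} → ChildOf a c → InSubtree c v → InSubtree a v
        InSubtree-child ch (d , c⊑d , v∈d) = d , ⊑-trans (ChildOf⇒⊑ ch) c⊑d , v∈d

        region : Fin n → Maybe (Node (tree D))
        region v with any? (λ c → childOf? a c ×-dec inSubtree? c v)
        ... | yes (c , _) = just c
        ... | no _ = nothing

        data RegionView (v : Fin n) : Maybe (Node (tree D)) → Set where
          branch : ∀ {c} → ChildOf a c → InSubtree c v → RegionView v (just c)
          outside : ¬ InSubtree a v → RegionView v nothing

        region-view : ∀ v → ¬ T (X v) → RegionView v (region v)
        region-view v v∉X with any? (λ c → childOf? a c ×-dec inSubtree? c v)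
        ... | yes (c , ch , v-in) = branch ch v-in
        ... | no no-branch = outside λ { (d , a⊑d , v∈d) →
                let (c , ch , c⊑d) = child-above a⊑d (λ { refl → v∉X (∈⇒T-lookup v∈d) })
                in no-branch (c , ch , d , c⊑d , v∈d) }

        region-branch : ∀ {c v} → ChildOf a c → InSubtree c v → ¬ T (X v) → region v ≡ just c
        region-branch {v = v} ch v-in v∉X with region v | region-view v v∉X
        ... | just c′ | branch ch′ v-in′ = cong just (child-unique ch′ ch v-in′ v-in v∉X)
        ... | nothing | outside v-out = ⊥-elim (v-out (InSubtree-child ch v-in))

        region-outside : ∀ {v} → ¬ InSubtree a v → ¬ T (X v) → region v ≡ nothing
        region-outside {v} v-out v∉X with region v | region-view v v∉X
        ... | just _ | branch ch v-in = ⊥-elim (v-out (InSubtree-child ch v-in))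
        ... | nothing | outside _ = refl

        stays-in-branch : ∀ {c u w} → ChildOf a c → InSubtree c u → ¬ T (X u) → T ((P ∖ X) w) → E G u w →
                          region w ≡ just c
        stays-in-branch {c} {u} {w} ch u-in u∉X w∈ uw with inSubtree? c w
        ... | yes w-in = region-branch ch w-in (∉X w∈)
        ... | no w-out with edge-leaves-subtree u-in (∈P w∈) w-out uw
        ... | _ , q , q-parent , u∈q with parent-unique q-parent ch
        ... | refl = ⊥-elim (u∉X (∈⇒T-lookup u∈q))

        region-edge : ∀ u w → T ((P ∖ X) u) → T ((P ∖ X) w) → E G u w → region u ≡ region w
        region-edge u w u∈ w∈ uw with region u | region-view u (∉X u∈)
        ... | just c | branch ch u-in = sym (stays-in-branch ch u-in (∉X u∈) w∈ uw)
        ... | nothing | outside u-out with inSubtree? a w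
        ... | no w-out = sym (region-outside w-out (∉X w∈))
        ... | yes w-in = ⊥-elim (∉X w∈ (∈⇒T-lookup
                (proj₁ (edge-leaves-subtree w-in (∈P u∈) u-out (Graph.sym G uw)))))

        regionClass : Maybe (Node (tree D)) → Fin n → Bool
        regionClass r w = (P ∖ X) w ∧ isYes (MaybeP.≡-dec Fin._≟_ (region w) r)

        regionClass⇒∖ : ∀ {r w} → T (regionClass r w) → T ((P ∖ X) w)
        regionClass⇒∖ {w = w} = ∧-elimˡ {(P ∖ X) w}

        regionClass⇒region : ∀ {r w} → T (regionClass r w) → region w ≡ r
        regionClass⇒region {w = w} = toWitness ∘ ∧-elimʳ {(P ∖ X) w}

        region-just : ∀ {c w} → ¬ T (X w) → region w ≡ just c → ChildOf a c × InSubtree c w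
        region-just {w = w} w∉X eq with region w | region-view w w∉X
        region-just w∉X refl | just _ | branch ch w-in = ch , w-in
        region-just w∉X () | nothing | outside _

        region-nothing : ∀ {w} → ¬ T (X w) → region w ≡ nothing → ¬ InSubtree a w
        region-nothing {w} w∉X eq with region w | region-view w w∉X
        region-nothing w∉X () | just _ | branch _ _
        region-nothing w∉X refl | nothing | outside w-out = w-out

        regionClass-light : ∀ r → 2 ℕ.* count (regionClass r) ≤ count P
        regionClass-light (just c) with childOf? a c
        ... | yes ch = ℕP.≤-trans (ℕP.*-monoʳ-≤ 2 (count-mono _ _ in-branch)) (child-light ch)
          where
          in-branch : ∀ w → T (regionClass (just c) w) → T (inSubtree c w)
          in-branch w w∈ = fromWitness (proj₂ (region-just (∉X (regionClass⇒∖ w∈)) (regionClass⇒region w∈)))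
        ... | no ¬ch = subst (λ m → 2 ℕ.* m ≤ count P) (sym (count-none _ empty)) z≤n
          where
          empty : ∀ w → ¬ T (regionClass (just c) w)
          empty w w∈ = ¬ch (proj₁ (region-just (∉X (regionClass⇒∖ w∈)) (regionClass⇒region w∈)))
        regionClass-light nothing = ℕP.≤-trans (ℕP.*-monoʳ-≤ 2 (count-mono _ _ outside-a)) outside-light
          where
          outside-a : ∀ w → T (regionClass nothing w) → T ((P ∖ inSubtree a) w)
          outside-a w w∈ = ∧-intro (∈P (regionClass⇒∖ w∈)) (not-intro λ w-in →
            region-nothing (∉X (regionClass⇒∖ w∈)) (regionClass⇒region w∈) (toWitness w-in))

        rep : Fin n → Fin n
        rep v = canonical (regionClass (region v)) v

        self∈regionClass : ∀ {v} → T ((P ∖ X) v) → T (regionClass (region v) v)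
        self∈regionClass v∈ = ∧-intro v∈ (fromWitness refl)

        rep∈regionClass : ∀ {v} → T ((P ∖ X) v) → T (regionClass (region v) (rep v))
        rep∈regionClass {v} v∈ = canonical∈ (regionClass (region v)) (self∈regionClass v∈)

        region-rep : ∀ {v} → T ((P ∖ X) v) → region (rep v) ≡ region v
        region-rep v∈ = regionClass⇒region (rep∈regionClass v∈)

        rep-edge : ∀ u w → T ((P ∖ X) u) → T ((P ∖ X) w) → E G u w → rep u ≡ rep w
        rep-edge u w u∈ w∈ uw =
          trans (cong (λ r → canonical (regionClass r) u) same-region)
                (canonical-unique (regionClass (region w)) (∧-intro u∈ (fromWitness same-region)) (self∈regionClass w∈))
          where
          same-region : region u ≡ region w
          same-region = region-edge u w u∈ w∈ uw

        rep-fibre-small : ∀ q → 2 ℕ.* count (λ w → (P ∖ X) w ∧ fibre rep q w) ≤ count P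
        rep-fibre-small q = ℕP.≤-trans (ℕP.*-monoʳ-≤ 2 (count-mono _ _ in-class)) (regionClass-light (region q))
          where
          in-class : ∀ w → T ((P ∖ X) w ∧ fibre rep q w) → T (regionClass (region q) w)
          in-class w w∈ = ∧-intro (∧-elimˡ {(P ∖ X) w} w∈)
            (fromWitness (trans (sym (region-rep (∧-elimˡ {(P ∖ X) w} w∈))) (cong region (toWitness (∧-elimʳ {(P ∖ X) w} w∈)))))

        separator : BalancedSeparator P
        separator = record
          { X = X
          ; X-size = subst₂ (λ x y → ℕtoℚ x ≤ℚ t (ℕtoℚ y) +ℚ 1ℚ) (∣∣≡count (bag D a)) (∣tabulate∣≡count P)
                            (proj₂ (tw (induced P)) a)
          ; rep = rep
          ; rep∈ = λ v v∈ → regionClass⇒∖ (rep∈regionClass v∈)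
          ; rep-edge = rep-edge
          ; rep-fibre-small = rep-fibre-small
          }

      nonempty-separator : ∀ {v} → T (P v) → BalancedSeparator P
      nonempty-separator Pv with greatest heavy
      ... | inj₁ none = ⊥-elim (none zero (root-heavy Pv))
      ... | inj₂ (a , a-heavy , deeper-light) = DeepestHeavy.separator a a-heavy deeper-light

    balancedSeparator : ∀ P → BalancedSeparator P
    balancedSeparator P with any? (T? ∘ P)
    ... | yes (_ , Pv) = Decomposition.nonempty-separator P Pv
    ... | no P-empty = record
      { X = λ _ → false
      ; X-size = subst (λ m → ℕtoℚ m ≤ℚ t (ℕtoℚ (count P)) +ℚ 1ℚ) (sym (count-none {n} (λ _ → false) λ _ ()))
          (ℚP.+-mono-≤ (t-nonNeg _ (ℕtoℚ-nonNeg (count P))) (ℚP.nonNegative⁻¹ 1ℚ))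
      ; rep = λ v → v
      ; rep∈ = λ v v∈ → ⊥-elim (P-empty (v , ∧-elimˡ {P v} v∈))
      ; rep-edge = λ u _ u∈ _ _ → ⊥-elim (P-empty (u , ∧-elimˡ {P u} u∈))
      ; rep-fibre-small = λ q → subst (λ m → 2 ℕ.* m ≤ count P)
          (sym (count-none _ λ w w∈ → P-empty (w , ∧-elimˡ {P w} (∧-elimˡ {P w ∧ not false} w∈)))) z≤n
      }

open Separators

module LinearAlgebra where
  open import Data.Nat as ℕ using (ℕ; zero; suc; z≤n; s≤s)
  import Data.Nat.Properties as ℕP
  open import Data.Bool using (Bool; true; false; T; if_then_else_; _∧_; _∨_)
  open import Data.Fin as Fin using (Fin; zero; suc)
  open import Data.Fin.Properties using (any?)
  open import Data.Rational
  open import Data.Rational.Properties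
  open import Data.Rational.Solver using (module +-*-Solver)
  open import Data.Empty using (⊥-elim)
  open import Data.Unit using (tt)
  open import Data.Product using (_,_)
  open import Function using (_∘_)
  open import Relation.Nullary using (¬_; yes; no)
  open import Relation.Nullary.Decidable using (isYes; T?; ¬?; _×-dec_; fromWitness)
  open import Relation.Binary.PropositionalEquality
  open +-*-Solver

  private variable n : ℕ

  ℚ^ : ℕ → Set
  ℚ^ n = Fin n → ℚ

  ∑ : ℚ^ n → ℚ
  ∑ {zero} x = 0ℚ
  ∑ {suc n} x = x zero + ∑ (x ∘ suc)

  ∑-cong : (x y : ℚ^ n) → (∀ v → x v ≡ y v) → ∑ x ≡ ∑ y
  ∑-cong {zero} x y x≗y = refl
  ∑-cong {suc n} x y x≗y = cong₂ _+_ (x≗y zero) (∑-cong (x ∘ suc) (y ∘ suc) (x≗y ∘ suc))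

  ∑-+ : (x y : ℚ^ n) → ∑ (λ v → x v + y v) ≡ ∑ x + ∑ y
  ∑-+ {zero} x y = refl
  ∑-+ {suc n} x y rewrite ∑-+ (x ∘ suc) (y ∘ suc) =
    solve 4 (λ a b c d → (a :+ b) :+ (c :+ d) := (a :+ c) :+ (b :+ d)) refl (x zero) (y zero) (∑ (x ∘ suc)) (∑ (y ∘ suc))

  ∑-* : ∀ a (x : ℚ^ n) → ∑ (λ v → a * x v) ≡ a * ∑ x
  ∑-* {zero} a x = sym (*-zeroʳ a)
  ∑-* {suc n} a x rewrite ∑-* a (x ∘ suc) = sym (*-distribˡ-+ a (x zero) (∑ (x ∘ suc)))

  ∑-mono : (x y : ℚ^ n) → (∀ v → x v ≤ y v) → ∑ x ≤ ∑ y
  ∑-mono {zero} x y x≤y = ≤-refl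
  ∑-mono {suc n} x y x≤y = +-mono-≤ (x≤y zero) (∑-mono (x ∘ suc) (y ∘ suc) (x≤y ∘ suc))

  indicator : Bool → ℚ
  indicator true = 1ℚ
  indicator false = 0ℚ

  ∑-indicator : (f : Fin n → Bool) → ∑ (indicator ∘ f) ≡ ℕtoℚ (count f)
  ∑-indicator {zero} f = refl
  ∑-indicator {suc n} f with f zero
  ... | true = trans (cong (1ℚ +_) (∑-indicator (f ∘ suc))) (sym (ℕtoℚ-+ 1 (count (f ∘ suc))))
  ... | false = trans (+-identityˡ _) (∑-indicator (f ∘ suc))

  record Linear (f : ℚ^ n → ℚ) : Set where
    field
      resp-≗ : ∀ x y → (∀ v → x v ≡ y v) → f x ≡ f y
      additive : ∀ x y → f (λ v → x v + y v) ≡ f x + f y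
      homogeneous : ∀ a x → f (λ v → a * x v) ≡ a * f x

  open Linear

  unit : Fin n → ℚ^ n
  unit j v = if isYes (v Fin.≟ j) then 1ℚ else 0ℚ

  unit-self : ∀ (j : Fin n) → unit j j ≡ 1ℚ
  unit-self j with j Fin.≟ j
  ... | yes _ = refl
  ... | no j≢j = ⊥-elim (j≢j refl)

  unit-other : ∀ (j v : Fin n) → v ≢ j → unit j v ≡ 0ℚ
  unit-other j v v≢j with v Fin.≟ j
  ... | yes v≡j = ⊥-elim (v≢j v≡j)
  ... | no _ = refl

  SupportedOn : ℚ^ n → (Fin n → Bool) → Set
  SupportedOn x S = ∀ v → ¬ T (S v) → x v ≡ 0ℚ

  linear-zero : ∀ {f : ℚ^ n → ℚ} → Linear f → ∀ x → (∀ v → x v ≡ 0ℚ) → f x ≡ 0ℚ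
  linear-zero {f = f} L x x≗0 =
    trans (resp-≗ L x (λ v → 0ℚ * x v) (λ v → trans (x≗0 v) (sym (*-zeroˡ (x v)))))
          (trans (homogeneous L 0ℚ x) (*-zeroˡ (f x)))

  linear-vanish : ∀ m {f : ℚ^ n → ℚ} → Linear f → (S : Fin n → Bool) → count S ≡ m →
                  (∀ j → T (S j) → f (unit j) ≡ 0ℚ) → ∀ x → SupportedOn x S → f x ≡ 0ℚ
  linear-vanish zero L S ∣S∣≡0 f[unit]≡0 x x-supp =
    linear-zero L x λ v → x-supp v λ Sv → ℕP.<⇒≢ (subst (0 ℕ.<_) ∣S∣≡0 (∃⇒count>0 S Sv)) refl
  linear-vanish (suc m) {f} L S ∣S∣≡1+m f[unit]≡0 x x-supp
    with count>0⇒∃ S (subst (0 ℕ.<_) (sym ∣S∣≡1+m) (s≤s z≤n))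
  ... | j , Sj = begin
    f x                              ≡⟨ resp-≗ L x (λ v → x j * unit j v + x′ v) split ⟩
    f (λ v → x j * unit j v + x′ v)  ≡⟨ additive L _ _ ⟩
    f (λ v → x j * unit j v) + f x′  ≡⟨ cong₂ _+_ (trans (homogeneous L (x j) (unit j))
                                                         (trans (cong (x j *_) (f[unit]≡0 j Sj)) (*-zeroʳ (x j))))
                                                  (linear-vanish m L (S without j) ∣S-j∣≡m
                                                     (λ i S-j-i → f[unit]≡0 i (∧-elimˡ {S i} S-j-i)) x′ x′-supp) ⟩
    0ℚ + 0ℚ                          ≡⟨⟩
    0ℚ                               ∎
    where
    open ≡-Reasoning
    x′ : ℚ^ _
    x′ v = if isYes (v Fin.≟ j) then 0ℚ else x v
    split : ∀ v → x v ≡ x j * unit j v + x′ v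
    split v with v Fin.≟ j
    ... | yes refl = sym (trans (cong (_+ 0ℚ) (*-identityʳ (x v))) (+-identityʳ (x v)))
    ... | no _ = sym (trans (cong (_+ x v) (*-zeroʳ (x j))) (+-identityˡ (x v)))
    ∣S-j∣≡m : count (S without j) ≡ m
    ∣S-j∣≡m = ℕP.suc-injective (trans (count-without S j Sj) ∣S∣≡1+m)
    x′-supp : SupportedOn x′ (S without j)
    x′-supp v v∉ with v Fin.≟ j
    ... | yes _ = refl
    ... | no _ = x-supp v (λ Sv → v∉ (∧-intro Sv _))

  linear-step : ∀ {f : ℚ^ n → ℚ} → Linear f → ∀ x γ y → f (λ v → x v + γ * y v) ≡ f x + γ * f y
  linear-step {f = f} L x γ y = trans (additive L x (λ v → γ * y v)) (cong (f x +_) (homogeneous L γ y))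

  linear-combination : ∀ {f g : ℚ^ n → ℚ} → Linear f → Linear g → ∀ β → Linear (λ x → f x - β * g x)
  linear-combination {f = f} {g} Lf Lg β = record
    { resp-≗ = λ x y x≗y → cong₂ (λ a b → a - β * b) (resp-≗ Lf x y x≗y) (resp-≗ Lg x y x≗y)
    ; additive = λ x y → trans (cong₂ (λ a b → a - β * b) (additive Lf x y) (additive Lg x y))
        (solve 5 (λ a b c d β → (a :+ b) :- β :* (c :+ d) := (a :- β :* c) :+ (b :- β :* d)) refl
           (f x) (f y) (g x) (g y) β)
    ; homogeneous = λ a x → trans (cong₂ (λ u w → u - β * w) (homogeneous Lf a x) (homogeneous Lg a x))
        (solve 4 (λ a u w β → a :* u :- β :* (a :* w) := a :* (u :- β :* w)) refl a (f x) (g x) β)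
    }

  record CommonZero {k} (fs : Fin k → ℚ^ n → ℚ) (S : Fin n → Bool) : Set where
    field
      point : ℚ^ n
      supported : SupportedOn point S
      pivot : Fin n
      pivot∈S : T (S pivot)
      point-pivot≢0 : point pivot ≢ 0ℚ
      vanishes : ∀ c → fs c point ≡ 0ℚ

  -- If fs zero vanishes on the unit vectors of S it vanishes on everything supported on S;
  -- otherwise eliminate it against a pivot j ∈ S, recurse on S without j and correct coordinate j.
  common-zero : ∀ k (fs : Fin k → ℚ^ n → ℚ) → (∀ c → Linear (fs c)) → (S : Fin n → Bool) → k ℕ.< count S →
                CommonZero fs S
  common-zero zero fs L S 0<∣S∣ with count>0⇒∃ S 0<∣S∣
  ... | j , Sj = record
    { point = unit j
    ; supported = λ v v∉S → unit-other j v λ { refl → v∉S Sj }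
    ; pivot = j
    ; pivot∈S = Sj
    ; point-pivot≢0 = λ unit≡0 → 1≢0 (trans (sym (unit-self j)) unit≡0)
    ; vanishes = λ ()
    }
  common-zero (suc k) fs L S k<∣S∣ with any? (λ j → T? (S j) ×-dec ¬? (fs zero (unit j) ≟ 0ℚ))
  ... | no f₀-vanishes = record
    { point = point
    ; supported = supported
    ; pivot = pivot
    ; pivot∈S = pivot∈S
    ; point-pivot≢0 = point-pivot≢0
    ; vanishes = λ { zero → linear-vanish (count S) (L zero) S refl f₀[unit]≡0 point supported
                   ; (suc c) → vanishes c }
    }
    where
    rest : CommonZero (fs ∘ suc) S
    rest = common-zero k (fs ∘ suc) (L ∘ suc) S (ℕP.<-trans (ℕP.n<1+n k) k<∣S∣)
    open CommonZero rest
    f₀[unit]≡0 : ∀ j → T (S j) → fs zero (unit j) ≡ 0ℚ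
    f₀[unit]≡0 j Sj with fs zero (unit j) ≟ 0ℚ
    ... | yes ≡0 = ≡0
    ... | no ≢0 = ⊥-elim (f₀-vanishes (j , Sj , ≢0))
  ... | yes (j , Sj , α≢0) = record
    { point = x
    ; supported = x-supp
    ; pivot = R.pivot
    ; pivot∈S = ∧-elimˡ {S R.pivot} R.pivot∈S
    ; point-pivot≢0 = λ x-i≡0 → R.point-pivot≢0 (trans (sym x≡x′) x-i≡0)
    ; vanishes = fs-x≡0
    }
    where
    α : ℚ
    α = fs zero (unit j)
    instance
      α-nonZero : NonZero α
      α-nonZero = ≢-nonZero α≢0
    β : Fin k → ℚ
    β c = fs (suc c) (unit j) * 1/ α
    g : Fin k → ℚ^ _ → ℚ
    g c y = fs (suc c) y - β c * fs zero y
    module R = CommonZero (common-zero k g (λ c → linear-combination (L (suc c)) (L zero) (β c)) (S without j)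
                             (ℕP.≤-pred (subst (suc k ℕ.<_) (sym (count-without S j Sj)) k<∣S∣)))
    γ : ℚ
    γ = - (fs zero R.point * 1/ α)
    x : ℚ^ _
    x v = R.point v + γ * unit j v
    x-supp : SupportedOn x S
    x-supp v v∉S = trans (cong₂ _+_ (R.supported v (λ S-j-v → v∉S (∧-elimˡ {S v} S-j-v)))
                                   (cong (γ *_) (unit-other j v λ { refl → v∉S Sj })))
                         (trans (+-identityˡ _) (*-zeroʳ γ))
    pivot≢j : R.pivot ≢ j
    pivot≢j i≡j = not-elim (∧-elimʳ {S R.pivot} R.pivot∈S) (fromWitness i≡j)
    x≡x′ : x R.pivot ≡ R.point R.pivot
    x≡x′ = trans (cong (λ u → R.point R.pivot + γ * u) (unit-other j R.pivot pivot≢j))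
                 (trans (cong (R.point R.pivot +_) (*-zeroʳ γ)) (+-identityʳ (R.point R.pivot)))
    fs-x≡0 : ∀ c → fs c x ≡ 0ℚ
    fs-x≡0 zero = trans (linear-step (L zero) R.point γ (unit j))
      (trans (solve 3 (λ y a⁻¹ a → y :+ (:- (y :* a⁻¹)) :* a := y :- y :* (a :* a⁻¹)) refl (fs zero R.point) (1/ α) α)
        (trans (cong (λ z → fs zero R.point - fs zero R.point * z) (*-inverseʳ α))
          (solve 1 (λ y → y :- y :* con 1ℚ := con 0ℚ) refl (fs zero R.point))))
    fs-x≡0 (suc c) = trans (linear-step (L (suc c)) R.point γ (unit j))
      (trans (solve 4 (λ F y a⁻¹ Fj → F :+ (:- (y :* a⁻¹)) :* Fj := F :- (Fj :* a⁻¹) :* y) refl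
                (fs (suc c) R.point) (fs zero R.point) (1/ α) (fs (suc c) (unit j)))
        (R.vanishes c))

  Linear-eval : ∀ (p : Fin n) → Linear (λ x → x p)
  Linear-eval p = record { resp-≗ = λ x y x≗y → x≗y p ; additive = λ _ _ → refl ; homogeneous = λ _ _ → refl }

  Linear-zero : Linear {n} (λ _ → 0ℚ)
  Linear-zero = record
    { resp-≗ = λ _ _ _ → refl ; additive = λ _ _ → sym (+-identityˡ 0ℚ) ; homogeneous = λ a _ → sym (*-zeroʳ a) }

  Linear-if : ∀ b {f : ℚ^ n → ℚ} → Linear f → Linear (λ x → if b then f x else 0ℚ)
  Linear-if true L = L
  Linear-if false L = Linear-zero

  Linear-∑ : ∀ {m} {g : Fin m → ℚ^ n → ℚ} → (∀ v → Linear (g v)) → Linear (λ x → ∑ λ v → g v x)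
  Linear-∑ {g = g} L = record
    { resp-≗ = λ x y x≗y → ∑-cong _ _ λ v → resp-≗ (L v) x y x≗y
    ; additive = λ x y → trans (∑-cong _ _ λ v → additive (L v) x y) (∑-+ (λ v → g v x) (λ v → g v y))
    ; homogeneous = λ a x → trans (∑-cong _ _ λ v → homogeneous (L v) a x) (∑-* a (λ v → g v x))
    }

  count-⋃ : ∀ {m n} (I : Fin m → Bool) (X : Fin m → Fin n → Bool) (b : ℚ) →
            (∀ p → T (I p) → ℕtoℚ (count (X p)) ≤ b) →
            ℕtoℚ (count (λ v → ⋃ I X v)) ≤ ℕtoℚ (count I) * b
  count-⋃ {zero} I X b bound = ≤-reflexive (trans (cong ℕtoℚ (count-none (⋃ I X) λ _ ())) (sym (*-zeroˡ b)))
  count-⋃ {suc m} {n} I X b bound = begin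
    ℕtoℚ (count (⋃ I X))                                ≤⟨ ℕtoℚ-mono-≤ (count-∨ head (⋃ (I ∘ suc) (X ∘ suc))) ⟩
    ℕtoℚ (count head ℕ.+ count (⋃ (I ∘ suc) (X ∘ suc)))  ≡⟨ ℕtoℚ-+ (count head) _ ⟩
    ℕtoℚ (count head) + ℕtoℚ (count (⋃ (I ∘ suc) (X ∘ suc)))
      ≤⟨ +-mono-≤ head-bound (count-⋃ (I ∘ suc) (X ∘ suc) b (bound ∘ suc)) ⟩
    indicator (I zero) * b + ℕtoℚ (count (I ∘ suc)) * b  ≡⟨ sym (*-distribʳ-+ b (indicator (I zero)) _) ⟩
    (indicator (I zero) + ℕtoℚ (count (I ∘ suc))) * b    ≡⟨ cong (_* b) (sym ℕtoℚ-count) ⟩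
    ℕtoℚ (count I) * b                                   ∎
    where
    open ≤-Reasoning
    head : Fin n → Bool
    head v = I zero ∧ X zero v
    head-bound : ℕtoℚ (count head) ≤ indicator (I zero) * b
    head-bound with I zero | bound zero
    ... | true | bound₀ = ≤-trans (bound₀ tt) (≤-reflexive (sym (*-identityˡ b)))
    ... | false | _ = ≤-reflexive (trans (cong ℕtoℚ (count-none (λ v → false ∧ X zero v) λ _ ())) (sym (*-zeroˡ b)))
    ℕtoℚ-count : ℕtoℚ (count I) ≡ indicator (I zero) + ℕtoℚ (count (I ∘ suc))
    ℕtoℚ-count with I zero
    ... | true = ℕtoℚ-+ 1 (count (I ∘ suc))
    ... | false = sym (+-identityˡ _)

  ∑-constant-on : ∀ {n} (f : Fin n → Bool) a → ∑ (λ v → if f v then a else 0ℚ) ≡ a * ℕtoℚ (count f)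
  ∑-constant-on f a = begin
    ∑ (λ v → if f v then a else 0ℚ)   ≡⟨ ∑-cong _ _ (λ v → if-indicator (f v)) ⟩
    ∑ (λ v → a * indicator (f v))     ≡⟨ ∑-* a (indicator ∘ f) ⟩
    a * ∑ (indicator ∘ f)             ≡⟨ cong (a *_) (∑-indicator f) ⟩
    a * ℕtoℚ (count f)                ∎
    where
    open ≡-Reasoning
    if-indicator : ∀ b → (if b then a else 0ℚ) ≡ a * indicator b
    if-indicator true = sym (*-identityʳ a)
    if-indicator false = sym (*-zeroʳ a)

open LinearAlgebra

module FractionalRounding where
  open import Data.Nat as ℕ using (ℕ; zero; suc; z≤n; s≤s)
  import Data.Nat.Properties as ℕP
  open import Data.Bool using (Bool; T; _∧_; not)
  open import Data.Fin as Fin using (Fin; zero; suc)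
  open import Data.List using (List; filter; allFin)
  open import Data.List.Membership.Propositional.Properties using (∈-filter⁺; ∈-filter⁻; ∈-allFin)
  open import Data.List.Relation.Unary.All as All using ()
  import Data.List.Extrema
  open import Data.Rational
  open import Data.Rational.Properties
  open import Data.Rational.Solver using (module +-*-Solver)
  open import Data.Empty using (⊥-elim)
  open import Data.Product using (_×_; _,_; proj₁; proj₂)
  open import Data.Sum using (_⊎_; inj₁; inj₂; [_,_]′)
  open import Relation.Nullary using (¬_; yes; no)
  open import Relation.Nullary.Decidable using (isYes; T?; toWitness; fromWitness; toWitnessFalse; fromWitnessFalse)
  open import Relation.Binary.Bundles using (DecTotalOrder)
  open import Relation.Binary.Definitions using (tri<; tri≈; tri>)
  open import Relation.Binary.PropositionalEquality
  open import Function using (_∘′_)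
  open +-*-Solver

  open Data.List.Extrema (DecTotalOrder.totalOrder ≤-decTotalOrder) using (argmin; f[argmin]≤f[xs]; argmin-sel)

  nonNeg*nonNeg : ∀ {a b} → 0ℚ ≤ a → 0ℚ ≤ b → 0ℚ ≤ a * b
  nonNeg*nonNeg {a} {b} 0≤a 0≤b = subst (_≤ a * b) (*-zeroʳ a) (*-monoˡ-≤-nonNeg a {{nonNegative 0≤a}} 0≤b)

  0≤1-x : ∀ {x} → x ≤ 1ℚ → 0ℚ ≤ 1ℚ - x
  0≤1-x {x} x≤1 = subst (_≤ 1ℚ - x) (+-inverseʳ x) (+-monoˡ-≤ (- x) x≤1)

  ≤∧≢⇒< : ∀ {p q : ℚ} → p ≤ q → p ≢ q → p < q
  ≤∧≢⇒< {p} {q} p≤q p≢q with <-cmp p q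
  ... | tri< p<q _ _ = p<q
  ... | tri≈ _ p≡q _ = ⊥-elim (p≢q p≡q)
  ... | tri> _ _ q<p = ⊥-elim (<-irrefl refl (<-≤-trans q<p p≤q))

  InUnitCube : ∀ {n} → ℚ^ n → Set
  InUnitCube x = ∀ p → 0ℚ ≤ x p × x p ≤ 1ℚ

  opaque
    fractional : ℚ → Bool
    fractional q = isYes (0ℚ <? q) ∧ isYes (q <? 1ℚ)

    fractional⁺ : ∀ {q} → 0ℚ < q → q < 1ℚ → T (fractional q)
    fractional⁺ {q} 0<q q<1 = ∧-intro {isYes (0ℚ <? q)} (fromWitness 0<q) (fromWitness q<1)

    fractional⁻ : ∀ {q} → T (fractional q) → 0ℚ < q × q < 1ℚ
    fractional⁻ {q} q-frac = toWitness (∧-elimˡ {isYes (0ℚ <? q)} q-frac) , toWitness (∧-elimʳ {isYes (0ℚ <? q)} q-frac)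

  module Rounding {n k : ℕ} (fs : Fin k → ℚ^ n → ℚ) (fs-linear : ∀ c → Linear (fs c)) (live : Fin n → Bool) where

    Fractional : ℚ^ n → Fin n → Bool
    Fractional x p = live p ∧ fractional (x p)

    -- Move x along a common zero d of fs supported on the fractional coordinates, as far as the
    -- cube allows; some fractional coordinate reaches 0 or 1.
    module Step (x : ℚ^ n) (x∈cube : InUnitCube x) (k<∣Fr∣ : k ℕ.< count (Fractional x)) where

      open CommonZero (common-zero k fs fs-linear (Fractional x) k<∣Fr∣) public
        renaming (point to d; supported to d-supp; pivot to j₀; vanishes to fs-d≡0)

      movable : Fin n → Bool
      movable j = Fractional x j ∧ not (isYes (d j ≟ 0ℚ))

      movable-j₀ : T (movable j₀)
      movable-j₀ = ∧-intro pivot∈S (fromWitnessFalse point-pivot≢0)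

      -- how far one can move from x along d before coordinate j leaves [0, 1]
      ratio : Fin n → ℚ
      ratio j with <-cmp 0ℚ (d j)
      ... | tri< 0<d _ _ = (1ℚ - x j) * (1/ d j) {{pos⇒nonZero (d j) {{positive 0<d}}}}
      ... | tri≈ _ _ _ = 0ℚ
      ... | tri> _ _ d<0 = x j * (1/ (- d j)) {{pos⇒nonZero (- d j) {{positive (neg-antimono-< d<0)}}}}

      ratio-nonNeg : ∀ j → 0ℚ ≤ ratio j
      ratio-nonNeg j with <-cmp 0ℚ (d j)
      ... | tri< 0<d _ _ = nonNeg*nonNeg (0≤1-x (proj₂ (x∈cube j)))
                             (<⇒≤ (positive⁻¹ _ {{1/pos⇒pos (d j) {{positive 0<d}}}}))
      ... | tri≈ _ _ _ = ≤-refl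
      ... | tri> _ _ d<0 = nonNeg*nonNeg (proj₁ (x∈cube j))
                             (<⇒≤ (positive⁻¹ _ {{1/pos⇒pos (- d j) {{positive (neg-antimono-< d<0)}}}}))

      ratio-reaches-boundary : ∀ j → d j ≢ 0ℚ →
        (0ℚ < d j × ratio j * d j ≡ 1ℚ - x j) ⊎ (d j < 0ℚ × ratio j * d j ≡ - x j)
      ratio-reaches-boundary j d≢0 with <-cmp 0ℚ (d j)
      ... | tri< 0<d _ _ = inj₁ (0<d , trans (*-assoc (1ℚ - x j) _ (d j))
            (trans (cong ((1ℚ - x j) *_) (*-inverseˡ (d j) {{pos⇒nonZero (d j) {{positive 0<d}}}})) (*-identityʳ _)))
      ... | tri≈ _ 0≡d _ = ⊥-elim (d≢0 (sym 0≡d))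
      ... | tri> _ _ d<0 = inj₂ (d<0 , trans
            (solve 3 (λ a i b → a :* i :* b := :- (a :* (i :* (:- b)))) refl (x j) (1/ (- d j)) (d j))
            (trans (cong (λ z → - (x j * z)) (*-inverseˡ (- d j))) (cong -_ (*-identityʳ (x j)))))
        where instance _ = pos⇒nonZero (- d j) {{positive (neg-antimono-< d<0)}}

      candidates : List (Fin n)
      candidates = filter (λ j → T? (movable j)) (allFin n)

      opaque
        j* : Fin n
        j* = argmin ratio j₀ candidates

        movable-j* : T (movable j*)
        movable-j* = [ (λ j*≡j₀ → subst (T ∘′ movable) (sym j*≡j₀) movable-j₀)
                     , (λ j*∈ → proj₂ (∈-filter⁻ (λ j → T? (movable j)) {xs = allFin n} j*∈)) ]′ (argmin-sel ratio j₀ candidates)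

        j*-minimal : ∀ j → T (movable j) → ratio j* ≤ ratio j
        j*-minimal j mj = All.lookup (f[argmin]≤f[xs] j₀ candidates) (∈-filter⁺ (λ j → T? (movable j)) (∈-allFin j) mj)

      μ : ℚ
      μ = ratio j*

      x′ : ℚ^ n
      x′ p = x p + μ * d p

      x′-fixed : ∀ p → d p ≡ 0ℚ → x′ p ≡ x p
      x′-fixed p d≡0 = trans (cong (λ z → x p + μ * z) d≡0) (trans (cong (x p +_) (*-zeroʳ μ)) (+-identityʳ (x p)))

      x′∈cube : InUnitCube x′
      x′∈cube p with d p ≟ 0ℚ
      ... | yes d≡0 = subst (λ z → 0ℚ ≤ z × z ≤ 1ℚ) (sym (x′-fixed p d≡0)) (x∈cube p)
      ... | no d≢0 with T? (Fractional x p)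
      ...   | no p∉Fr = ⊥-elim (d≢0 (d-supp p p∉Fr))
      ...   | yes p∈Fr = within (ratio-reaches-boundary p d≢0) (j*-minimal p (∧-intro p∈Fr (fromWitnessFalse d≢0)))
        where
        within : (0ℚ < d p × ratio p * d p ≡ 1ℚ - x p) ⊎ (d p < 0ℚ × ratio p * d p ≡ - x p) →
                 μ ≤ ratio p → 0ℚ ≤ x′ p × x′ p ≤ 1ℚ
        within (inj₁ (0<d , r*d≡1-x)) μ≤r =
          ≤-trans (proj₁ (x∈cube p)) (subst (_≤ x′ p) (+-identityʳ (x p))
            (+-monoʳ-≤ (x p) (nonNeg*nonNeg (ratio-nonNeg j*) (<⇒≤ 0<d)))) ,
          ≤-trans (+-monoʳ-≤ (x p) (≤-trans (*-monoʳ-≤-nonNeg (d p) {{nonNegative (<⇒≤ 0<d)}} μ≤r) (≤-reflexive r*d≡1-x)))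
            (≤-reflexive (solve 1 (λ a → a :+ (con 1ℚ :- a) := con 1ℚ) refl (x p)))
        within (inj₂ (d<0 , r*d≡-x)) μ≤r =
          ≤-trans (≤-reflexive (sym (+-inverseʳ (x p))))
            (+-monoʳ-≤ (x p) (≤-trans (≤-reflexive (sym r*d≡-x)) (*-monoʳ-≤-nonPos (d p) {{nonPositive (<⇒≤ d<0)}} μ≤r))) ,
          ≤-trans (subst (x′ p ≤_) (+-identityʳ (x p)) (+-monoʳ-≤ (x p)
            (subst (μ * d p ≤_) (*-zeroˡ (d p)) (*-monoʳ-≤-nonPos (d p) {{nonPositive (<⇒≤ d<0)}} (ratio-nonNeg j*)))))
            (proj₂ (x∈cube p))

      j*-settled : ¬ T (fractional (x′ j*))
      j*-settled x′j*-frac with ratio-reaches-boundary j* (toWitnessFalse (∧-elimʳ {Fractional x j*} movable-j*))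
      ... | inj₁ (_ , r*d≡1-x) = <-irrefl x′≡1 (proj₂ (fractional⁻ x′j*-frac))
        where
        x′≡1 : x′ j* ≡ 1ℚ
        x′≡1 = trans (cong (x j* +_) r*d≡1-x) (solve 1 (λ a → a :+ (con 1ℚ :- a) := con 1ℚ) refl (x j*))
      ... | inj₂ (_ , r*d≡-x) = <-irrefl (sym x′≡0) (proj₁ (fractional⁻ x′j*-frac))
        where
        x′≡0 : x′ j* ≡ 0ℚ
        x′≡0 = trans (cong (x j* +_) r*d≡-x) (+-inverseʳ (x j*))

      Fractional-shrinks : ∀ p → T (Fractional x′ p) → T ((Fractional x without j*) p)
      Fractional-shrinks p p∈Fr′ with p Fin.≟ j*
      ... | yes refl = ⊥-elim (j*-settled (∧-elimʳ {live j*} p∈Fr′))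
      ... | no _ with T? (Fractional x p)
      ...   | yes p∈Fr = ∧-intro p∈Fr _
      ...   | no p∉Fr = ⊥-elim (p∉Fr (subst (λ z → T (live p ∧ fractional z)) (x′-fixed p (d-supp p p∉Fr)) p∈Fr′))

      count-decreases : count (Fractional x′) ℕ.< count (Fractional x)
      count-decreases = subst (count (Fractional x′) ℕ.<_)
        (count-without (Fractional x) j* (∧-elimˡ {Fractional x j*} movable-j*))
        (s≤s (count-mono _ _ Fractional-shrinks))

    record FewFractional (Inv : ℚ^ n → Set) : Set where
      field
        point : ℚ^ n
        point∈cube : InUnitCube point
        invariant : Inv point
        few : count (Fractional point) ℕ.≤ k

    fewFractional : (Inv : ℚ^ n → Set) → (∀ x d μ → (∀ c → fs c d ≡ 0ℚ) → Inv x → Inv (λ p → x p + μ * d p)) →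
                    ∀ x → InUnitCube x → Inv x → FewFractional Inv
    fewFractional Inv preserved x x∈cube inv = go (count (Fractional x)) x ℕP.≤-refl x∈cube inv
      where
      go : ∀ m x → count (Fractional x) ℕ.≤ m → InUnitCube x → Inv x → FewFractional Inv
      go m x ∣Fr∣≤m x∈cube inv with count (Fractional x) ℕ.≤? k
      ... | yes ∣Fr∣≤k = record { point = x ; point∈cube = x∈cube ; invariant = inv ; few = ∣Fr∣≤k }
      go zero x ∣Fr∣≤0 x∈cube inv | no ∣Fr∣≰k = ⊥-elim (∣Fr∣≰k (ℕP.≤-trans ∣Fr∣≤0 z≤n))
      go (suc m) x ∣Fr∣≤1+m x∈cube inv | no ∣Fr∣≰k =
        go m S.x′ (ℕP.≤-pred (ℕP.≤-trans S.count-decreases ∣Fr∣≤1+m)) S.x′∈cube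
           (preserved x S.d S.μ S.fs-d≡0 inv)
        where module S = Step x x∈cube (ℕP.≰⇒> ∣Fr∣≰k)

open FractionalRounding

open import Data.Nat as ℕ using (ℕ; _^_)
open import Data.Fin using (Fin)
open import Data.Fin.Subset using (Subset; _∈_; _∉_; _∩_; ∣_∣)
open import Data.Maybe using (Maybe)
open import Data.Product using (Σ; _×_; _,_)
open import Data.Sum using (_⊎_)
open import Relation.Nullary using (¬_)
open import Data.Rational using (ℚ; _+_; _*_; 0ℚ; 1ℚ; _≤_)

module Construction {n k : ℕ} (G : Graph n) (c : Fin n → Maybe (Fin k)) (t : ℚ → ℚ)
  (t-nonNeg : ∀ x → 0ℚ ≤ x → 0ℚ ≤ t x)
  (t-mono : ∀ x y → 0ℚ ≤ x → x ≤ y → t x ≤ t y)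
  (tw : ∀ (H : Subgraph G) → TreewidthAtMost H (t (ℕtoℚ ∣ U H ∣))) where

  open import Data.Nat using (zero; suc; z≤n)
  import Data.Nat.Properties as ℕP
  open import Data.Nat.Solver using () renaming (module +-*-Solver to ℕ-Solver)
  open import Data.Bool using (Bool; true; false; T; if_then_else_; _∧_; _∨_)
  open import Data.Fin as Fin using (Fin; zero; suc)
  open import Data.Fin.Properties using (any?)
  open import Data.Vec using (tabulate; lookup)
  open import Data.Vec.Properties using (lookup∘tabulate; lookup-zipWith)
  open import Data.Rational hiding (∣_∣)
  open import Data.Rational.Properties
  open import Data.Rational.Solver using () renaming (module +-*-Solver to ℚ-Solver)
  open import Data.Empty using (⊥-elim)
  open import Data.Unit using (tt)
  open import Data.Product using (Σ; ∃; _×_; _,_; proj₁; proj₂)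
  open import Data.Sum using (_⊎_; inj₁; inj₂)
  import Data.Sum
  open import Function using (_∘_; case_of_)
  open import Relation.Nullary using (¬_; yes; no)
  open import Relation.Nullary.Decidable using (isYes; toWitness; fromWitness; map′)
  open import Relation.Binary.Definitions using (DecidableEquality)
  open import Relation.Binary.PropositionalEquality

  anchor : ∀ {n} → Fin n → Fin n
  anchor {suc n} _ = zero

  anchor-constant : ∀ {n} (u v : Fin n) → anchor u ≡ anchor v
  anchor-constant {suc n} _ _ = refl

  two-thirds : ∀ m {a f b N} → a ℕ.≤ f → 2 ℕ.* f ℕ.≤ b → m ℕ.* b ℕ.≤ N → 3 ℕ.* (m ℕ.* a) ℕ.≤ 2 ℕ.* N
  two-thirds m {a} {f} {b} {N} a≤f 2f≤b mb≤N = begin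
    3 ℕ.* (m ℕ.* a)         ≤⟨ ℕP.*-monoˡ-≤ (m ℕ.* a) (ℕP.n≤1+n 3) ⟩
    4 ℕ.* (m ℕ.* a)         ≡⟨ ℕ-Solver.solve 2 (λ m a → con 4 :* (m :* a) := con 2 :* (m :* (con 2 :* a))) refl m a ⟩
    2 ℕ.* (m ℕ.* (2 ℕ.* a)) ≤⟨ ℕP.*-monoʳ-≤ 2 (ℕP.*-monoʳ-≤ m (ℕP.≤-trans (ℕP.*-monoʳ-≤ 2 a≤f) 2f≤b)) ⟩
    2 ℕ.* (m ℕ.* b)         ≤⟨ ℕP.*-monoʳ-≤ 2 mb≤N ⟩
    2 ℕ.* N                 ∎
    where
    open ℕP.≤-Reasoning
    open ℕ-Solver

  open BalancedSeparators G t t-nonNeg tw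

  data Label : Set where
    separator sideA sideB : Label
    piece : Fin n → Label

  piece-injective : ∀ {p q} → piece p ≡ piece q → p ≡ q
  piece-injective refl = refl

  _≟L_ : DecidableEquality Label
  separator ≟L separator = yes refl
  separator ≟L sideA = no λ ()
  separator ≟L sideB = no λ ()
  separator ≟L piece _ = no λ ()
  sideA ≟L separator = no λ ()
  sideA ≟L sideA = yes refl
  sideA ≟L sideB = no λ ()
  sideA ≟L piece _ = no λ ()
  sideB ≟L separator = no λ ()
  sideB ≟L sideA = no λ ()
  sideB ≟L sideB = yes refl
  sideB ≟L piece _ = no λ ()
  piece _ ≟L separator = no λ ()
  piece _ ≟L sideA = no λ ()
  piece _ ≟L sideB = no λ ()
  piece p ≟L piece q = map′ (cong piece) piece-injective (p Fin.≟ q)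

  Labelling : Set
  Labelling = Fin n → Label

  hasLabel : Label → Labelling → Fin n → Bool
  hasLabel l ℓ v = isYes (ℓ v ≟L l)

  colour : Fin k → Fin n → Bool
  colour i = lookup (colourClass c i)

  shareA shareB : Label → ℚ^ n → ℚ
  shareA sideA x = 1ℚ
  shareA (piece p) x = x p
  shareA _ x = 0ℚ
  shareB sideB x = 1ℚ
  shareB (piece p) x = 1ℚ - x p
  shareB _ x = 0ℚ

  weight : (Label → ℚ^ n → ℚ) → Labelling → ℚ^ n → Fin k → ℚ
  weight σ ℓ x i = ∑ λ v → if colour i v then σ (ℓ v) x else 0ℚ

  Balanced : (Label → ℚ^ n → ℚ) → Labelling → ℚ^ n → Set
  Balanced σ ℓ x = ∀ i → ℕtoℚ 2 * weight σ ℓ x i ≤ ℕtoℚ (count (colour i))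

  Balanced-mono : ∀ σ ℓ x ℓ′ x′ → (∀ v → σ (ℓ′ v) x′ ≤ σ (ℓ v) x) → Balanced σ ℓ x → Balanced σ ℓ′ x′
  Balanced-mono σ ℓ x ℓ′ x′ σ′≤σ bal i = ≤-trans
    (*-monoˡ-≤-nonNeg (ℕtoℚ 2) (∑-mono _ _ λ v → if-mono (colour i v) (σ′≤σ v))) (bal i)
    where
    if-mono : ∀ b {a a′} → a ≤ a′ → (if b then a else 0ℚ) ≤ (if b then a′ else 0ℚ)
    if-mono true a≤a′ = a≤a′
    if-mono false _ = ≤-refl

  colour-balance : ∀ σ s ℓ x → (∀ v → σ (ℓ v) x ≡ indicator (hasLabel s ℓ v)) → Balanced σ ℓ x →
                   ∀ i → 2 ℕ.* ∣ tabulate (hasLabel s ℓ) ∩ colourClass c i ∣ ℕ.≤ ∣ colourClass c i ∣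
  colour-balance σ s ℓ x σ≡𝟙 bal i =
    subst₂ (λ a b → 2 ℕ.* a ℕ.≤ b) (sym ∣side∩colour∣) (sym (∣∣≡count (colourClass c i)))
      (ℕtoℚ-cancel-≤ (≤-trans (≤-reflexive (trans (ℕtoℚ-* 2 (count side∧colour)) (cong (ℕtoℚ 2 *_) (sym weight≡count)))) (bal i)))
    where
    side∧colour : Fin n → Bool
    side∧colour v = hasLabel s ℓ v ∧ colour i v
    if-indicator : ∀ a b → (if b then indicator a else 0ℚ) ≡ indicator (a ∧ b)
    if-indicator true true = refl
    if-indicator false true = refl
    if-indicator true false = refl
    if-indicator false false = refl
    weight≡count : weight σ ℓ x i ≡ ℕtoℚ (count side∧colour)
    weight≡count = trans (∑-cong _ _ λ v → trans (cong (λ z → if colour i v then z else 0ℚ) (σ≡𝟙 v))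
                                                 (if-indicator (hasLabel s ℓ v) (colour i v)))
                         (∑-indicator side∧colour)
    ∣side∩colour∣ : ∣ tabulate (hasLabel s ℓ) ∩ colourClass c i ∣ ≡ count side∧colour
    ∣side∩colour∣ = trans (∣∣≡count (tabulate (hasLabel s ℓ) ∩ colourClass c i)) (count-cong _ side∧colour λ v →
      trans (lookup-zipWith _∧_ v (tabulate (hasLabel s ℓ)) (colourClass c i))
            (cong (_∧ colour i v) (lookup∘tabulate (hasLabel s ℓ) v)))

  cost : ℕ → ℚ
  cost j = t (twoThirdsPow j n) + 1ℚ

  budget : ℕ → ℚ
  budget zero = 0ℚ
  budget (suc i) = budget i + cost i

  record Stage (i : ℕ) : Set where
    field
      label : Labelling
      share : ℚ^ n
      edge-ok : ∀ u v → E G u v → label u ≡ label v ⊎ label u ≡ separator ⊎ label v ≡ separator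
      share∈cube : InUnitCube share
      balancedA : Balanced shareA label share
      balancedB : Balanced shareB label share
      piece-small : ∀ p → 3 ^ i ℕ.* count (hasLabel (piece p) label) ℕ.≤ 2 ^ i ℕ.* n
      separator-small : ℕtoℚ (count (hasLabel separator label)) ≤ ℕtoℚ k * budget i

  record SettledStage (i : ℕ) : Set where
    field
      stage : Stage i
    open Stage stage public
    field
      live : Fin n → Bool
      few-live : count live ℕ.≤ k
      pieces-live : ∀ v p → label v ≡ piece p → T (live p)

  initial : Stage 0
  initial = record
    { label = piece ∘ anchor
    ; share = λ _ → ½
    ; edge-ok = λ u v _ → inj₁ (cong piece (anchor-constant u v))
    ; share∈cube = λ _ → toWitness {a? = 0ℚ ≤? ½} tt , toWitness {a? = ½ ≤? 1ℚ} tt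
    ; balancedA = half-balanced shareA refl
    ; balancedB = half-balanced shareB refl
    ; piece-small = λ p → subst₂ ℕ._≤_ (sym (ℕP.*-identityˡ _)) (sym (ℕP.*-identityˡ n)) (count≤n _)
    ; separator-small = ≤-reflexive (trans (cong ℕtoℚ (count-none (hasLabel separator (piece ∘ anchor)) λ _ ()))
                                           (sym (*-zeroʳ (ℕtoℚ k))))
    }
    where
    half-balanced : ∀ σ → (∀ {p} → σ (piece p) (λ _ → ½) ≡ ½) → Balanced σ (piece ∘ anchor) (λ _ → ½)
    half-balanced σ σ≡½ i = ≤-reflexive (begin
      ℕtoℚ 2 * weight σ (piece ∘ anchor) (λ _ → ½) i ≡⟨ cong (ℕtoℚ 2 *_) (trans
                                                          (∑-cong _ _ λ v → cong (if colour i v then_else 0ℚ) σ≡½)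
                                                          (∑-constant-on (colour i) ½)) ⟩
      ℕtoℚ 2 * (½ * ℕtoℚ (count (colour i)))         ≡⟨ sym (*-assoc (ℕtoℚ 2) ½ (ℕtoℚ (count (colour i)))) ⟩
      1ℚ * ℕtoℚ (count (colour i))                   ≡⟨ *-identityˡ (ℕtoℚ (count (colour i))) ⟩
      ℕtoℚ (count (colour i))                        ∎)
      where open ≡-Reasoning

  cost-nonNeg : ∀ j → 0ℚ ≤ cost j
  cost-nonNeg j = +-mono-≤ (t-nonNeg _ (ℕtoℚ≤twoThirdsPow j n 0 (subst (ℕ._≤ 2 ^ j ℕ.* n) (sym (ℕP.*-zeroʳ (3 ^ j))) z≤n)))
                           (nonNegative⁻¹ 1ℚ)

  module Refine {i : ℕ} (st : SettledStage i) where
    open SettledStage st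

    module Sep (p : Fin n) = BalancedSeparator (balancedSeparator (hasLabel (piece p) label))

    relabel : Fin n → Label → Label
    relabel v (piece p) = if Sep.X p v then separator else piece (Sep.rep p v)
    relabel v l = l

    label′ : Labelling
    label′ v = relabel v (label v)

    share′ : ℚ^ n
    share′ q with label q
    ... | piece p = share p
    ... | separator = share q
    ... | sideA = share q
    ... | sideB = share q

    share′-piece : ∀ {q p} → label q ≡ piece p → share′ q ≡ share p
    share′-piece eq rewrite eq = refl

    data Relabelled (v : Fin n) : Set where
      cut : ∀ {p} → label v ≡ piece p → T (Sep.X p v) → label′ v ≡ separator → Relabelled v
      kept : ∀ {p} → label v ≡ piece p → ¬ T (Sep.X p v) → label′ v ≡ piece (Sep.rep p v) → Relabelled v
      untouched : (∀ p → label v ≢ piece p) → label′ v ≡ label v → Relabelled v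

    relabelled : ∀ v → Relabelled v
    relabelled v with label v in lv
    ... | piece p with Sep.X p v in Xv
    ...   | true = cut lv (subst T (sym Xv) tt)
                      (trans (cong (relabel v) lv) (cong (if_then separator else piece (Sep.rep p v)) Xv))
    ...   | false = kept lv (subst T Xv)
                      (trans (cong (relabel v) lv) (cong (if_then separator else piece (Sep.rep p v)) Xv))
    relabelled v | separator = untouched (λ p e → case trans (sym lv) e of λ ()) (trans (cong (relabel v) lv) (sym lv))
    relabelled v | sideA = untouched (λ p e → case trans (sym lv) e of λ ()) (trans (cong (relabel v) lv) (sym lv))
    relabelled v | sideB = untouched (λ p e → case trans (sym lv) e of λ ()) (trans (cong (relabel v) lv) (sym lv))

    in-piece-∖X : ∀ {v p} → label v ≡ piece p → ¬ T (Sep.X p v) → T ((hasLabel (piece p) label ∖ Sep.X p) v)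
    in-piece-∖X lv v∉X = ∧-intro (fromWitness lv) (not-intro v∉X)

    rep-in-piece : ∀ {v p} → label v ≡ piece p → ¬ T (Sep.X p v) → label (Sep.rep p v) ≡ piece p
    rep-in-piece {v} {p} lv v∉X =
      toWitness (∧-elimˡ {hasLabel (piece p) label (Sep.rep p v)} (Sep.rep∈ p v (in-piece-∖X lv v∉X)))

    edge-ok′ : ∀ u v → E G u v → label′ u ≡ label′ v ⊎ label′ u ≡ separator ⊎ label′ v ≡ separator
    edge-ok′ u v uv with edge-ok u v uv
    ... | inj₂ (inj₁ u-sep) = inj₂ (inj₁ (cong (relabel u) u-sep))
    ... | inj₂ (inj₂ v-sep) = inj₂ (inj₂ (cong (relabel v) v-sep))
    ... | inj₁ same with relabelled u | relabelled v
    ...   | cut _ _ u-sep | _ = inj₂ (inj₁ u-sep)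
    ...   | _ | cut _ _ v-sep = inj₂ (inj₂ v-sep)
    ...   | kept lu u∉X u′ | kept lv v∉X v′ with piece-injective (trans (sym lu) (trans same lv))
    ...     | refl = inj₁ (trans u′ (trans (cong piece (Sep.rep-edge _ u v (in-piece-∖X lu u∉X) (in-piece-∖X lv v∉X) uv))
                                             (sym v′)))
    edge-ok′ u v uv | inj₁ same | kept lu _ _ | untouched v-np _ = ⊥-elim (v-np _ (trans (sym same) lu))
    edge-ok′ u v uv | inj₁ same | untouched u-np _ | kept lv _ _ = ⊥-elim (u-np _ (trans same lv))
    edge-ok′ u v uv | inj₁ same | untouched _ u′ | untouched _ v′ = inj₁ (trans u′ (trans same (sym v′)))

    share∈cube′ : InUnitCube share′
    share∈cube′ q with label q
    ... | piece p = share∈cube p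
    ... | separator = share∈cube q
    ... | sideA = share∈cube q
    ... | sideB = share∈cube q

    shareA-decreases : ∀ v → shareA (label′ v) share′ ≤ shareA (label v) share
    shareA-decreases v with relabelled v
    ... | cut lv _ v′ rewrite v′ | lv = proj₁ (share∈cube _)
    ... | kept lv v∉X v′ rewrite v′ | lv = ≤-reflexive (share′-piece (rep-in-piece lv v∉X))
    ... | untouched v-np v′ rewrite v′ with label v
    ...   | piece p = ⊥-elim (v-np p refl)
    ...   | separator = ≤-refl
    ...   | sideA = ≤-refl
    ...   | sideB = ≤-refl

    shareB-decreases : ∀ v → shareB (label′ v) share′ ≤ shareB (label v) share
    shareB-decreases v with relabelled v
    ... | cut lv _ v′ rewrite v′ | lv = 0≤1-x (proj₂ (share∈cube _))
    ... | kept lv v∉X v′ rewrite v′ | lv = ≤-reflexive (cong (λ z → 1ℚ - z) (share′-piece (rep-in-piece lv v∉X)))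
    ... | untouched v-np v′ rewrite v′ with label v
    ...   | piece p = ⊥-elim (v-np p refl)
    ...   | separator = ≤-refl
    ...   | sideA = ≤-refl
    ...   | sideB = ≤-refl

    new-piece : ∀ {w q} → label′ w ≡ piece q → ∃ λ p → label w ≡ piece p × ¬ T (Sep.X p w) × Sep.rep p w ≡ q
    new-piece {w} w′ with relabelled w
    ... | cut _ _ w-sep = case trans (sym w-sep) w′ of λ ()
    ... | kept lw w∉X w-rep = _ , lw , w∉X , piece-injective (trans (sym w-rep) w′)
    ... | untouched w-np w-same = ⊥-elim (w-np _ (trans (sym w-same) w′))

    no-new-piece : ∀ {q} → (∀ p → label q ≢ piece p) →
                   3 ^ suc i ℕ.* count (hasLabel (piece q) label′) ℕ.≤ 2 ^ suc i ℕ.* n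
    no-new-piece {q} q-np = subst (λ m → 3 ^ suc i ℕ.* m ℕ.≤ 2 ^ suc i ℕ.* n) (sym (count-none _ no-member))
                              (subst (ℕ._≤ 2 ^ suc i ℕ.* n) (sym (ℕP.*-zeroʳ (3 ^ suc i))) z≤n)
      where
      no-member : ∀ w → ¬ T (hasLabel (piece q) label′ w)
      no-member w w∈ with new-piece (toWitness w∈)
      ... | _ , lw , w∉X , refl = q-np _ (rep-in-piece lw w∉X)

    new-piece-small : ∀ {q p} → label q ≡ piece p →
                      3 ^ suc i ℕ.* count (hasLabel (piece q) label′) ℕ.≤ 2 ^ suc i ℕ.* n
    new-piece-small {q} {p} lq = subst₂ ℕ._≤_ (sym (ℕP.*-assoc 3 (3 ^ i) _)) (sym (ℕP.*-assoc 2 (2 ^ i) n))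
      (two-thirds (3 ^ i) (count-mono _ _ in-fibre) (Sep.rep-fibre-small p q) (piece-small p))
      where
      in-fibre : ∀ w → T (hasLabel (piece q) label′ w) → T ((hasLabel (piece p) label ∖ Sep.X p) w ∧ fibre (Sep.rep p) q w)
      in-fibre w w∈ with new-piece (toWitness w∈)
      ... | p′ , lw , w∉X , refl with piece-injective (trans (sym (rep-in-piece lw w∉X)) lq)
      ...   | refl = ∧-intro (in-piece-∖X lw w∉X) (fromWitness refl)

    piece-small′ : ∀ q → 3 ^ suc i ℕ.* count (hasLabel (piece q) label′) ℕ.≤ 2 ^ suc i ℕ.* n
    piece-small′ q with label q in lq
    ... | piece p = new-piece-small lq
    ... | separator = no-new-piece (λ p e → case trans (sym lq) e of λ ())
    ... | sideA = no-new-piece (λ p e → case trans (sym lq) e of λ ())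
    ... | sideB = no-new-piece (λ p e → case trans (sym lq) e of λ ())

    separator-growth : ∀ p → T (live p) → ℕtoℚ (count (Sep.X p)) ≤ cost i
    separator-growth p _ = ≤-trans (Sep.X-size p)
      (+-monoˡ-≤ 1ℚ (t-mono _ _ (ℕtoℚ-nonNeg piece-size) (ℕtoℚ≤twoThirdsPow i n piece-size (piece-small p))))
      where
      piece-size : ℕ
      piece-size = count (hasLabel (piece p) label)

    new-separator : ∀ w → T (hasLabel separator label′ w) → T (hasLabel separator label w ∨ ⋃ live Sep.X w)
    new-separator w w∈ with relabelled w
    ... | cut lw Xw _ = ∨-introʳ (hasLabel separator label w) (∈⋃ live Sep.X (pieces-live w _ lw) Xw)
    ... | kept _ _ w′ = case trans (sym (toWitness {a? = label′ w ≟L separator} w∈)) w′ of λ ()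
    ... | untouched _ w′ = ∨-introˡ (⋃ live Sep.X w) (fromWitness (trans (sym w′) (toWitness {a? = label′ w ≟L separator} w∈)))

    separator-small′ : ℕtoℚ (count (hasLabel separator label′)) ≤ ℕtoℚ k * budget (suc i)
    separator-small′ = begin
      ℕtoℚ (count (hasLabel separator label′))
        ≤⟨ ℕtoℚ-mono-≤ (ℕP.≤-trans (count-mono _ _ new-separator) (count-∨ (hasLabel separator label) (⋃ live Sep.X))) ⟩
      ℕtoℚ (count (hasLabel separator label) ℕ.+ count (⋃ live Sep.X))
        ≡⟨ ℕtoℚ-+ (count (hasLabel separator label)) _ ⟩
      ℕtoℚ (count (hasLabel separator label)) + ℕtoℚ (count (⋃ live Sep.X))
        ≤⟨ +-mono-≤ separator-small (count-⋃ live Sep.X (cost i) separator-growth) ⟩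
      ℕtoℚ k * budget i + ℕtoℚ (count live) * cost i
        ≤⟨ +-monoʳ-≤ (ℕtoℚ k * budget i) (*-monoʳ-≤-nonNeg (cost i) {{nonNegative (cost-nonNeg i)}} (ℕtoℚ-mono-≤ few-live)) ⟩
      ℕtoℚ k * budget i + ℕtoℚ k * cost i
        ≡⟨ sym (*-distribˡ-+ (ℕtoℚ k) (budget i) (cost i)) ⟩
      ℕtoℚ k * budget (suc i) ∎
      where open ≤-Reasoning

    refined : Stage (suc i)
    refined = record
      { label = label′
      ; share = share′
      ; edge-ok = edge-ok′
      ; share∈cube = share∈cube′
      ; balancedA = Balanced-mono shareA label share label′ share′ shareA-decreases balancedA
      ; balancedB = Balanced-mono shareB label share label′ share′ shareB-decreases balancedB
      ; piece-small = piece-small′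
      ; separator-small = separator-small′
      }

  pieceValue : ℚ^ n → Label → ℚ
  pieceValue x (piece p) = x p
  pieceValue x separator = 0ℚ
  pieceValue x sideA = 0ℚ
  pieceValue x sideB = 0ℚ

  Linear-pieceValue : ∀ l → Linear (λ x → pieceValue x l)
  Linear-pieceValue (piece p) = Linear-eval p
  Linear-pieceValue separator = Linear-zero
  Linear-pieceValue sideA = Linear-zero
  Linear-pieceValue sideB = Linear-zero

  shareA-step : ∀ l x d μ → shareA l (λ p → x p + μ * d p) ≡ shareA l x + μ * pieceValue d l
  shareA-step (piece p) x d μ = refl
  shareA-step separator x d μ = sym (trans (cong (0ℚ +_) (*-zeroʳ μ)) (+-identityʳ 0ℚ))
  shareA-step sideA x d μ = sym (trans (cong (1ℚ +_) (*-zeroʳ μ)) (+-identityʳ 1ℚ))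
  shareA-step sideB x d μ = sym (trans (cong (0ℚ +_) (*-zeroʳ μ)) (+-identityʳ 0ℚ))

  shareB-step : ∀ l x d μ → shareB l (λ p → x p + μ * d p) ≡ shareB l x + (- μ) * pieceValue d l
  shareB-step (piece p) x d μ =
    ℚ-Solver.solve 3 (λ a m e → con 1ℚ :- (a :+ m :* e) := (con 1ℚ :- a) :+ (:- m) :* e) refl (x p) μ (d p)
    where open ℚ-Solver
  shareB-step separator x d μ = sym (trans (cong (0ℚ +_) (*-zeroʳ (- μ))) (+-identityʳ 0ℚ))
  shareB-step sideA x d μ = sym (trans (cong (0ℚ +_) (*-zeroʳ (- μ))) (+-identityʳ 0ℚ))
  shareB-step sideB x d μ = sym (trans (cong (1ℚ +_) (*-zeroʳ (- μ))) (+-identityʳ 1ℚ))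

  pieceWeight : Labelling → Fin k → ℚ^ n → ℚ
  pieceWeight ℓ col x = ∑ λ v → if colour col v then pieceValue x (ℓ v) else 0ℚ

  weight-step : ∀ σ ℓ x d μ ν → (∀ l → σ l (λ p → x p + μ * d p) ≡ σ l x + ν * pieceValue d l) →
                ∀ col → weight σ ℓ (λ p → x p + μ * d p) col ≡ weight σ ℓ x col + ν * pieceWeight ℓ col d
  weight-step σ ℓ x d μ ν σ-step col =
    trans (∑-cong _ _ pointwise)
          (trans (∑-+ (λ v → if colour col v then σ (ℓ v) x else 0ℚ) _)
                 (cong (weight σ ℓ x col +_) (∑-* ν (λ v → if colour col v then pieceValue d (ℓ v) else 0ℚ))))
    where
    pointwise : ∀ v → (if colour col v then σ (ℓ v) (λ p → x p + μ * d p) else 0ℚ)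
                    ≡ (if colour col v then σ (ℓ v) x else 0ℚ) + ν * (if colour col v then pieceValue d (ℓ v) else 0ℚ)
    pointwise v with colour col v
    ... | true = σ-step (ℓ v)
    ... | false = sym (trans (cong (0ℚ +_) (*-zeroʳ ν)) (+-identityʳ 0ℚ))

  Balanced-step : ∀ σ ℓ x d μ ν → (∀ l → σ l (λ p → x p + μ * d p) ≡ σ l x + ν * pieceValue d l) →
                  (∀ col → pieceWeight ℓ col d ≡ 0ℚ) → Balanced σ ℓ x → Balanced σ ℓ (λ p → x p + μ * d p)
  Balanced-step σ ℓ x d μ ν σ-step d-neutral bal col = subst (λ w → ℕtoℚ 2 * w ≤ ℕtoℚ (count (colour col)))
    (sym (trans (weight-step σ ℓ x d μ ν σ-step col)
                (trans (cong (λ z → weight σ ℓ x col + ν * z) (d-neutral col))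
                       (trans (cong (weight σ ℓ x col +_) (*-zeroʳ ν)) (+-identityʳ (weight σ ℓ x col))))))
    (bal col)

  module Settle {i : ℕ} (st : Stage i) where
    open Stage st

    nonempty : Fin n → Bool
    nonempty p = isYes (any? λ v → label v ≟L piece p)

    open Rounding (pieceWeight label) (λ col → Linear-∑ λ v → Linear-if (colour col v) (Linear-pieceValue (label v)))
                  nonempty

    BothBalanced : ℚ^ n → Set
    BothBalanced x = Balanced shareA label x × Balanced shareB label x

    opaque
      rounded : FewFractional BothBalanced
      rounded = fewFractional BothBalanced
        (λ x d μ d-neutral (balA , balB) →
           Balanced-step shareA label x d μ μ (λ l → shareA-step l x d μ) d-neutral balA ,
           Balanced-step shareB label x d μ (- μ) (λ l → shareB-step l x d μ) d-neutral balB)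
        share share∈cube (balancedA , balancedB)

    open FewFractional rounded renaming (point to y)

    settle : Label → Label
    settle (piece p) with y p ≟ 1ℚ | y p ≟ 0ℚ
    ... | yes _ | _ = sideA
    ... | no _ | yes _ = sideB
    ... | no _ | no _ = piece p
    settle separator = separator
    settle sideA = sideA
    settle sideB = sideB

    settle-piece : ∀ l {q} → settle l ≡ piece q → l ≡ piece q × y q ≢ 1ℚ × y q ≢ 0ℚ
    settle-piece (piece p) eq with y p ≟ 1ℚ | y p ≟ 0ℚ
    settle-piece (piece p) refl | no y≢1 | no y≢0 = refl , y≢1 , y≢0

    settle-separator : ∀ l → settle l ≡ separator → l ≡ separator
    settle-separator (piece p) eq with y p ≟ 1ℚ | y p ≟ 0ℚ
    settle-separator (piece p) () | yes _ | _
    settle-separator (piece p) () | no _ | yes _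
    settle-separator (piece p) () | no _ | no _
    settle-separator separator _ = refl

    shareA-settle : ∀ l → shareA (settle l) y ≡ shareA l y
    shareA-settle (piece p) with y p ≟ 1ℚ | y p ≟ 0ℚ
    ... | yes y≡1 | _ = sym y≡1
    ... | no _ | yes y≡0 = sym y≡0
    ... | no _ | no _ = refl
    shareA-settle separator = refl
    shareA-settle sideA = refl
    shareA-settle sideB = refl

    shareB-settle : ∀ l → shareB (settle l) y ≡ shareB l y
    shareB-settle (piece p) with y p ≟ 1ℚ | y p ≟ 0ℚ
    ... | yes y≡1 | _ rewrite y≡1 = refl
    ... | no _ | yes y≡0 rewrite y≡0 = refl
    ... | no _ | no _ = refl
    shareB-settle separator = refl
    shareB-settle sideA = refl
    shareB-settle sideB = refl

    settled : SettledStage i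
    settled = record
      { stage = record
        { label = settle ∘ label
        ; share = y
        ; edge-ok = λ u v uv → Data.Sum.map (cong settle) (Data.Sum.map (cong settle) (cong settle)) (edge-ok u v uv)
        ; share∈cube = point∈cube
        ; balancedA = Balanced-mono shareA label y (settle ∘ label) y (≤-reflexive ∘ shareA-settle ∘ label)
                                    (proj₁ invariant)
        ; balancedB = Balanced-mono shareB label y (settle ∘ label) y (≤-reflexive ∘ shareB-settle ∘ label)
                                    (proj₂ invariant)
        ; piece-small = λ p → ℕP.≤-trans (ℕP.*-monoʳ-≤ (3 ^ i) (count-mono _ _ λ w w∈ →
            fromWitness (proj₁ (settle-piece (label w) (toWitness w∈))))) (piece-small p)
        ; separator-small = ≤-trans (ℕtoℚ-mono-≤ (count-mono _ _ λ w w∈ →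
            fromWitness (settle-separator (label w) (toWitness w∈)))) separator-small
        }
      ; live = Fractional y
      ; few-live = few
      ; pieces-live = λ v p lv → let (lv′ , y≢1 , y≢0) = settle-piece (label v) lv
                                     (0≤y , y≤1) = point∈cube p in
          ∧-intro {nonempty p} (fromWitness (v , lv′))
            (fractional⁺ (≤∧≢⇒< 0≤y (y≢0 ∘ sym)) (≤∧≢⇒< y≤1 y≢1))
      }

  settledStage : ∀ i → SettledStage i
  settledStage zero = Settle.settled initial
  settledStage (suc i) = Settle.settled (Refine.refined (settledStage i))

  budget-suc : ∀ L → budget (suc L) ≡ sumUpTo L (λ j → t (twoThirdsPow j n) + 1ℚ)
  budget-suc zero = +-identityˡ (cost 0)
  budget-suc (suc L) = cong (_+ cost (suc L)) (budget-suc L)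

  module Finish {L : ℕ} (st : SettledStage L) (pieces-tiny : n ℕ.* 2 ^ L ℕ.≤ 3 ^ L) where
    open SettledStage st

    close : Label → Label
    close (piece _) = separator
    close separator = separator
    close sideA = sideA
    close sideB = sideB

    final : Labelling
    final = close ∘ label

    S A B : Subset n
    S = tabulate (hasLabel separator final)
    A = tabulate (hasLabel sideA final)
    B = tabulate (hasLabel sideB final)

    final⇒∈ : ∀ l {v} → final v ≡ l → v ∈ tabulate (hasLabel l final)
    final⇒∈ l eq = ∈-tabulate⁺ (hasLabel l final) (fromWitness eq)

    ∈⇒final : ∀ l {v} → v ∈ tabulate (hasLabel l final) → final v ≡ l
    ∈⇒final l v∈ = toWitness (∈-tabulate⁻ (hasLabel l final) v∈)

    only-in : ∀ {v} l → final v ≡ l → ∀ l′ → l′ ≢ l → v ∉ tabulate (hasLabel l′ final)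
    only-in l fv l′ l′≢l v∈ = l′≢l (trans (sym (∈⇒final l′ v∈)) fv)

    in-S : ∀ {v} → final v ≡ separator → v ∈ S × v ∉ A × v ∉ B
    in-S fv = final⇒∈ separator fv , only-in separator fv sideA (λ ()) , only-in separator fv sideB (λ ())

    in-A : ∀ {v} → final v ≡ sideA → v ∉ S × v ∈ A × v ∉ B
    in-A fv = only-in sideA fv separator (λ ()) , final⇒∈ sideA fv , only-in sideA fv sideB (λ ())

    in-B : ∀ {v} → final v ≡ sideB → v ∉ S × v ∉ A × v ∈ B
    in-B fv = only-in sideB fv separator (λ ()) , only-in sideB fv sideA (λ ()) , final⇒∈ sideB fv

    partition : ∀ v → (v ∈ S × v ∉ A × v ∉ B) ⊎ (v ∉ S × v ∈ A × v ∉ B) ⊎ (v ∉ S × v ∉ A × v ∈ B)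
    partition v with label v in lv
    ... | piece _ = inj₁ (in-S (cong close lv))
    ... | separator = inj₁ (in-S (cong close lv))
    ... | sideA = inj₂ (inj₁ (in-A (cong close lv)))
    ... | sideB = inj₂ (inj₂ (in-B (cong close lv)))

    no-edge : ∀ u v → u ∈ A → v ∈ B → ¬ E G u v
    no-edge u v u∈A v∈B uv with edge-ok u v uv
    ... | inj₁ same = case trans (sym (∈⇒final sideA u∈A)) (trans (cong close same) (∈⇒final sideB v∈B)) of λ ()
    ... | inj₂ (inj₁ u-sep) = case trans (sym (∈⇒final sideA u∈A)) (cong close u-sep) of λ ()
    ... | inj₂ (inj₂ v-sep) = case trans (sym (∈⇒final sideB v∈B)) (cong close v-sep) of λ ()

    shareA-close : ∀ l → shareA (close l) share ≤ shareA l share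
    shareA-close (piece p) = proj₁ (share∈cube p)
    shareA-close separator = ≤-refl
    shareA-close sideA = ≤-refl
    shareA-close sideB = ≤-refl

    shareB-close : ∀ l → shareB (close l) share ≤ shareB l share
    shareB-close (piece p) = 0≤1-x (proj₂ (share∈cube p))
    shareB-close separator = ≤-refl
    shareB-close sideA = ≤-refl
    shareB-close sideB = ≤-refl

    shareA-indicator : ∀ l → shareA (close l) share ≡ indicator (isYes (close l ≟L sideA))
    shareA-indicator (piece _) = refl
    shareA-indicator separator = refl
    shareA-indicator sideA = refl
    shareA-indicator sideB = refl

    shareB-indicator : ∀ l → shareB (close l) share ≡ indicator (isYes (close l ≟L sideB))
    shareB-indicator (piece _) = refl
    shareB-indicator separator = refl
    shareB-indicator sideA = refl
    shareB-indicator sideB = refl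

    A-balanced : ∀ i → 2 ℕ.* ∣ A ∩ colourClass c i ∣ ℕ.≤ ∣ colourClass c i ∣
    A-balanced = colour-balance shareA sideA final share (shareA-indicator ∘ label)
                   (Balanced-mono shareA label share final share (shareA-close ∘ label) balancedA)

    B-balanced : ∀ i → 2 ℕ.* ∣ B ∩ colourClass c i ∣ ℕ.≤ ∣ colourClass c i ∣
    B-balanced = colour-balance shareB sideB final share (shareB-indicator ∘ label)
                   (Balanced-mono shareB label share final share (shareB-close ∘ label) balancedB)

    piece-tiny : ∀ p → T (live p) → ℕtoℚ (count (hasLabel (piece p) label)) ≤ 1ℚ
    piece-tiny p _ = ℕtoℚ-mono-≤ (ℕP.*-cancelˡ-≤ (3 ^ L) {{ℕP.m^n≢0 3 L}} (begin
      3 ^ L ℕ.* count (hasLabel (piece p) label) ≤⟨ piece-small p ⟩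
      2 ^ L ℕ.* n                               ≡⟨ ℕP.*-comm (2 ^ L) n ⟩
      n ℕ.* 2 ^ L                               ≤⟨ pieces-tiny ⟩
      3 ^ L                                     ≡⟨ ℕP.*-identityʳ (3 ^ L) ⟨
      3 ^ L ℕ.* 1                               ∎))
      where open ℕP.≤-Reasoning

    in-separator-or-piece : ∀ w → T (hasLabel separator final w) →
                            T (hasLabel separator label w ∨ ⋃ live (λ p → hasLabel (piece p) label) w)
    in-separator-or-piece w w∈ with label w in lw
    ... | piece p = ∨-introʳ (isYes (piece p ≟L separator)) (∈⋃ live _ (pieces-live w p lw) (fromWitness lw))
    ... | separator = ∨-introˡ (⋃ live (λ p → hasLabel (piece p) label) w) tt
    ... | sideA = case toWitness {a? = close sideA ≟L separator} w∈ of λ ()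
    ... | sideB = case toWitness {a? = close sideB ≟L separator} w∈ of λ ()

    S-small : ℕtoℚ ∣ S ∣ ≤ ℕtoℚ k + ℕtoℚ k * sumUpTo L (λ j → t (twoThirdsPow j n) + 1ℚ)
    S-small = begin
      ℕtoℚ ∣ S ∣                                              ≡⟨ cong ℕtoℚ (∣tabulate∣≡count (hasLabel separator final)) ⟩
      ℕtoℚ (count (hasLabel separator final))
        ≤⟨ ℕtoℚ-mono-≤ (ℕP.≤-trans (count-mono _ _ in-separator-or-piece) (count-∨ (hasLabel separator label) pieces)) ⟩
      ℕtoℚ (count (hasLabel separator label) ℕ.+ count pieces) ≡⟨ ℕtoℚ-+ (count (hasLabel separator label)) _ ⟩
      ℕtoℚ (count (hasLabel separator label)) + ℕtoℚ (count pieces)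
        ≤⟨ +-mono-≤ separator-small (count-⋃ live (λ p → hasLabel (piece p) label) 1ℚ piece-tiny) ⟩
      ℕtoℚ k * budget L + ℕtoℚ (count live) * 1ℚ
        ≤⟨ +-monoʳ-≤ (ℕtoℚ k * budget L) (≤-trans (≤-reflexive (*-identityʳ _)) (ℕtoℚ-mono-≤ few-live)) ⟩
      ℕtoℚ k * budget L + ℕtoℚ k                              ≡⟨ +-comm (ℕtoℚ k * budget L) (ℕtoℚ k) ⟩
      ℕtoℚ k + ℕtoℚ k * budget L
        ≤⟨ +-monoʳ-≤ (ℕtoℚ k) (*-monoˡ-≤-nonNeg (ℕtoℚ k) {{nonNegative (ℕtoℚ-nonNeg k)}} budget≤) ⟩
      ℕtoℚ k + ℕtoℚ k * budget (suc L)                        ≡⟨ cong (λ z → ℕtoℚ k + ℕtoℚ k * z) (budget-suc L) ⟩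
      ℕtoℚ k + ℕtoℚ k * sumUpTo L (λ j → t (twoThirdsPow j n) + 1ℚ) ∎
      where
      open ≤-Reasoning
      pieces : Fin n → Bool
      pieces = ⋃ live (λ p → hasLabel (piece p) label)
      budget≤ : budget L ≤ budget (suc L)
      budget≤ = subst (_≤ budget (suc L)) (+-identityʳ (budget L)) (+-monoʳ-≤ (budget L) (cost-nonNeg L))

corollary2p6 :
    (n k : ℕ) (G : Graph n) (c : Fin n → Maybe (Fin k)) (t : ℚ → ℚ) →
    (∀ x → 0ℚ ≤ x → 0ℚ ≤ t x) →
    (∀ x y → 0ℚ ≤ x → x ≤ y → t x ≤ t y) →
    (∀ (H : Subgraph G) → TreewidthAtMost H (t (ℕtoℚ ∣ U H ∣))) →
    (L : ℕ) → n ℕ.* 2 ^ L ℕ.≤ 3 ^ L →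
    (∀ m → n ℕ.* 2 ^ m ℕ.≤ 3 ^ m → L ℕ.≤ m) →
    Σ (Subset n) λ S → Σ (Subset n) λ A → Σ (Subset n) λ B →
      (∀ v → ((v ∈ S) × (v ∉ A) × (v ∉ B))
           ⊎ ((v ∉ S) × (v ∈ A) × (v ∉ B))
           ⊎ ((v ∉ S) × (v ∉ A) × (v ∈ B)))
      × (∀ u v → u ∈ A → v ∈ B → ¬ E G u v)
      × (∀ i → (2 ℕ.* ∣ A ∩ colourClass c i ∣ ℕ.≤ ∣ colourClass c i ∣)
             × (2 ℕ.* ∣ B ∩ colourClass c i ∣ ℕ.≤ ∣ colourClass c i ∣))
      × (ℕtoℚ ∣ S ∣ ≤ ℕtoℚ k + ℕtoℚ k * sumUpTo L (λ i → t (twoThirdsPow i n) + 1ℚ))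
corollary2p6 n k G c t t-nonNeg t-mono tw L pieces-tiny _ =
  S , A , B , partition , no-edge , (λ i → A-balanced i , B-balanced i) , S-small
  where
  open Construction G c t t-nonNeg t-mono tw
  open Finish (settledStage L) pieces-tiny
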